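{- Let $n>1$. Then \[|MC_n|\ \ge\ |\{G\subseteq K_{n,n}: G\text{ is elementary}\}|\ \ge\ 2^{n^2}\left(1-\frac{2n^4}{2^n}\right)=2^{n^2}(1-o_n(1)).\]
   Context: Graphs $G\subseteq K_{n,n}$ are spanning subgraphs of $K_{n,n}$ identified with edge sets. $G$ is matching-covered if its edge set is the union of the edge sets of a nonempty collection of perfect matchings of $K_{n,n}$; $MC_n$ is the set of matching-covered $G\subseteq K_{n,n}$. $G\subseteq K_{n,n}$ is elementary if it is connected (on all $2n$ vertices) and matching-covered. -}

module Defs where

open import Data.Nat using (ℕ; zero; suc; _+_; _*_; _^_; _≤_)
open import Data.Bool using (Bool; true)
open import Data.Fin using (Fin)
open import Data.Vec using (Vec; lookup)
open import Data.Sum using (_⊎_; inj₁; inj₂)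
open import Data.List using (List; []; length)
open import Data.List.Relation.Unary.Any using (Any)
open import Data.List.Relation.Unary.All using (All)
open import Data.List.Relation.Unary.Unique.Propositional using (Unique)
open import Data.Fin.Permutation using (Permutation′; _⟨$⟩ʳ_)
open import Data.Product using (Σ; _×_; ∃)
open import Relation.Binary.PropositionalEquality using (_≡_; _≢_)
open import Function.Bundles using (_⇔_)

-- A spanning subgraph G ⊆ K_{n,n}, identified with its edge set:
-- G has the edge (left i, right j) iff the (i,j) entry is true.
BipGraph : ℕ → Set
BipGraph n = Vec (Vec Bool n) n

Edge : ∀ {n} → BipGraph n → Fin n → Fin n → Set
Edge G i j = lookup (lookup G i) j ≡ true

PerfectMatching : ℕ → Set
PerfectMatching n = Permutation′ n

InMatching : ∀ {n} → PerfectMatching n → Fin n → Fin n → Set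
InMatching π i j = π ⟨$⟩ʳ i ≡ j

MatchingCovered : ∀ {n} → BipGraph n → Set
MatchingCovered {n} G =
  Σ (List (PerfectMatching n)) λ ms →
    (ms ≢ []) × (∀ i j → Edge G i j ⇔ Any (λ π → InMatching π i j) ms)

Vertex : ℕ → Set
Vertex n = Fin n ⊎ Fin n

data Adj {n} (G : BipGraph n) : Vertex n → Vertex n → Set where
  lr : ∀ {i j} → Edge G i j → Adj G (inj₁ i) (inj₂ j)
  rl : ∀ {i j} → Edge G i j → Adj G (inj₂ j) (inj₁ i)

data Walk {n} (G : BipGraph n) : Vertex n → Vertex n → Set where
  here : ∀ {u} → Walk G u u
  step : ∀ {u v w} → Adj G u v → Walk G v w → Walk G u w

Connected : ∀ {n} → BipGraph n → Set
Connected G = ∀ u v → Walk G u v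

Elementary : ∀ {n} → BipGraph n → Set
Elementary G = Connected G × MatchingCovered G

-- "The set {G : P G} has at least k elements":
-- there is a duplicate-free list of k graphs all satisfying P.
AtLeast : ∀ {n} → (BipGraph n → Set) → ℕ → Set
AtLeast {n} P k =
  Σ (List (BipGraph n)) λ xs → Unique xs × All P xs × length xs ≡ k

module Submission where

-- Call G ⊆ K_{n,n} a surplus graph if every set S of left vertices with 0 < ∣ S ∣ < n has more
-- than ∣ S ∣ neighbours. Surplus graphs are elementary. Forcing an edge (i₀ , j₀) and deleting j₀
-- from the other rows keeps Hall's condition, so by Hall's theorem every edge lies on a perfect
-- matching inside G; and a proper set of left vertices and its complement cannot have disjoint
-- neighbourhoods, so the left vertices are connected through common neighbours.
--
-- A graph without surplus has some S, 0 < ∣ S ∣ < n, all of whose rows lie in a T with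
-- ∣ T ∣ ≤ ∣ S ∣, and for fixed S and T only a 2 ^ -(n - ∣ T ∣) ∣ S ∣ fraction of all graphs do so.
-- Replacing S by one of its vertices when ∣ S ∣ ≤ 2, T by the complement of a column it misses when
-- ∣ S ∣ ≥ n - 2, and keeping (S , T) otherwise, the union bound leaves at most
-- (8 n (n + 1)² + 512) 2 ^ (n² - n) graphs without surplus, below 2 n⁴ 2 ^ (n² - n) once n ≥ 18.
-- For n ≤ 17 the claimed bound is void, since then 2 ^ n ≤ 2 n⁴.

open import Defs

open import Data.Bool.Base using (true; false)
import Data.Bool.Properties as Bool
open import Data.Empty using (⊥-elim)
open import Data.Fin.Base using (Fin; zero; suc; punchOut; fromℕ<; toℕ)
open import Data.Fin.Permutation using (Permutation′; _⟨$⟩ʳ_; permutation)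
import Data.Fin.Properties as Fin
open import Data.Fin.Subset
open import Data.Fin.Subset.Properties
open import Data.List.Base
  using (List; []; _∷_; _++_; map; length; filter; cartesianProduct; cartesianProductWith; allFin)
open import Data.List.Properties
  using (++-identityʳ; length-++; length-map; length-tabulate; length-filter; filter-++; filter-≐; filter-all)
open import Data.List.Membership.Propositional using (lose; find) renaming (_∈_ to _∈ₗ_)
open import Data.List.Membership.Propositional.Properties
  using (∈-map⁺; ∈-map⁻; ∈-filter⁺; ∈-filter⁻; ∈-cartesianProduct⁺; ∈-cartesianProduct⁻; ∈-cartesianProductWith⁺; ∈-allFin)
import Data.List.Relation.Unary.All as All
open import Data.List.Relation.Unary.All.Properties using (all-filter)
open import Data.List.Relation.Unary.AllPairs using ([]; _∷_)
open import Data.List.Relation.Unary.Any using (Any; here; there; any?)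
open import Data.List.Relation.Unary.Any.Properties using (¬Any[])
open import Data.List.Relation.Unary.Unique.Propositional using (Unique)
import Data.List.Relation.Unary.Unique.Propositional.Properties as Unique
open import Data.Nat.Base using (ℕ; zero; suc; _+_; _*_; _^_; _∸_; _≤_; _<_; z≤n; s≤s)
open import Data.Nat.Induction using (<-wellFounded)
open import Data.Nat.Properties
open import Data.Nat.Tactic.RingSolver using (solve-∀)
open import Data.Product using (Σ; ∃; ∃₂; _×_; _,_; proj₁; proj₂; uncurry)
open import Data.Sum using (_⊎_; inj₁; inj₂; [_,_]′)
open import Data.Unit.Base using (tt) renaming (⊤ to Unit)
open import Data.Vec.Base using (Vec; []; _∷_; here; there; lookup)
open import Data.Vec.Properties using ([]=⇒lookup; lookup⇒[]=; ∷-injective)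
open import Function.Base using (_∘_; id)
open import Function.Bundles using (_⇔_; mk⇔; Equivalence)
open import Function.Definitions using (Injective)
open import Induction.WellFounded using (Acc; acc)
open import Level using (0ℓ)
open import Relation.Binary.PropositionalEquality
open import Relation.Nullary using (¬_; Dec; yes; no; does; contradiction)
open import Relation.Nullary.Decidable using (_×-dec_; _⊎-dec_; _→-dec_; ¬?; from-yes)
open import Relation.Unary using (Pred; Decidable)

private
  variable
    k m n : ℕ

∣p∪q∣+∣p∩q∣≡∣p∣+∣q∣ : (p q : Subset n) → ∣ p ∪ q ∣ + ∣ p ∩ q ∣ ≡ ∣ p ∣ + ∣ q ∣
∣p∪q∣+∣p∩q∣≡∣p∣+∣q∣ []           []           = refl
∣p∪q∣+∣p∩q∣≡∣p∣+∣q∣ (true ∷ p)   (true ∷ q)   =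
  cong suc (trans (+-suc _ _) (trans (cong suc (∣p∪q∣+∣p∩q∣≡∣p∣+∣q∣ p q)) (sym (+-suc _ _))))
∣p∪q∣+∣p∩q∣≡∣p∣+∣q∣ (true ∷ p)   (false ∷ q)  = cong suc (∣p∪q∣+∣p∩q∣≡∣p∣+∣q∣ p q)
∣p∪q∣+∣p∩q∣≡∣p∣+∣q∣ (false ∷ p)  (true ∷ q)   =
  trans (cong suc (∣p∪q∣+∣p∩q∣≡∣p∣+∣q∣ p q)) (sym (+-suc _ _))
∣p∪q∣+∣p∩q∣≡∣p∣+∣q∣ (false ∷ p)  (false ∷ q)  = ∣p∪q∣+∣p∩q∣≡∣p∣+∣q∣ p q

x∈p⇒∣p∣≡1+∣p-x∣ : {x : Fin n} {p : Subset n} → x ∈ p → ∣ p ∣ ≡ suc ∣ p - x ∣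
x∈p⇒∣p∣≡1+∣p-x∣ {x = zero}  {true ∷ p}  here       = cong (suc ∘ ∣_∣) (sym (p─⊥≡p p))
x∈p⇒∣p∣≡1+∣p-x∣ {x = suc x} {true ∷ p}  (there x∈) = cong suc (x∈p⇒∣p∣≡1+∣p-x∣ x∈)
x∈p⇒∣p∣≡1+∣p-x∣ {x = suc x} {false ∷ p} (there x∈) = x∈p⇒∣p∣≡1+∣p-x∣ x∈

∣p∣≤1+∣p-x∣ : (x : Fin n) (p : Subset n) → ∣ p ∣ ≤ suc ∣ p - x ∣
∣p∣≤1+∣p-x∣ x p with x ∈? p
... | yes x∈p = ≤-reflexive (x∈p⇒∣p∣≡1+∣p-x∣ x∈p)
... | no  x∉p = m≤n⇒m≤1+n (p⊆q⇒∣p∣≤∣q∣ {p = p} {q = p - x} λ y∈p → x∈p∧x≢y⇒x∈p-y y∈p λ { refl → x∉p y∈p })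

x∉p-x : {x : Fin n} {p : Subset n} → x ∉ p - x
x∉p-x {x = zero}  {b ∷ p} ()
x∉p-x {x = suc x} {b ∷ p} (there x∈) = x∉p-x x∈

x∈p-y⇒x≢y : {x y : Fin n} {p : Subset n} → x ∈ p - y → x ≢ y
x∈p-y⇒x≢y x∈ refl = x∉p-x x∈

x∈p⇒0<∣p∣ : {x : Fin n} {p : Subset n} → x ∈ p → 0 < ∣ p ∣
x∈p⇒0<∣p∣ {p = p} x∈p = ≤-<-trans z≤n (x∈p⇒∣p-x∣<∣p∣ {p = p} x∈p)

0<∣p∣⇒Nonempty : (p : Subset n) → 0 < ∣ p ∣ → Nonempty p
0<∣p∣⇒Nonempty (true ∷ p)  _   = zero , here
0<∣p∣⇒Nonempty (false ∷ p) 0<∣p∣ = let x , x∈p = 0<∣p∣⇒Nonempty p 0<∣p∣ in suc x , there x∈p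

Empty⇒∣p∣≡0 : {p : Subset n} → Empty p → ∣ p ∣ ≡ 0
Empty⇒∣p∣≡0 {n} empty = trans (cong ∣_∣ (Empty-unique empty)) (∣⊥∣≡0 n)

x∉p⇒∣p∣<n : {x : Fin n} {p : Subset n} → x ∉ p → ∣ p ∣ < n
x∉p⇒∣p∣<n {n} {x} {p} x∉p = subst (∣ p ∣ <_) (∣⊤∣≡n n) (p⊂q⇒∣p∣<∣q∣ {p = p} {q = ⊤} (⊆⊤ , x , ∈⊤ , x∉p))

∣p∣≤1⇒x∈p⇒y∈p⇒x≡y : {x y : Fin n} {p : Subset n} → ∣ p ∣ ≤ 1 → x ∈ p → y ∈ p → x ≡ y
∣p∣≤1⇒x∈p⇒y∈p⇒x≡y {x = x} {y} {p} ∣p∣≤1 x∈p y∈p with x Fin.≟ y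
... | yes x≡y = x≡y
... | no  x≢y = contradiction (≤-trans (s≤s (x∈p⇒0<∣p∣ y∈p-x)) (≤-reflexive (sym (x∈p⇒∣p∣≡1+∣p-x∣ x∈p)))) (<⇒≱ (s≤s ∣p∣≤1))
  where
  y∈p-x : y ∈ p - x
  y∈p-x = x∈p∧x≢y⇒x∈p-y y∈p (x≢y ∘ sym)

2≤∣p∣⇒∃-distinct : (p : Subset n) → 2 ≤ ∣ p ∣ → ∃₂ λ y z → y ∈ p × z ∈ p × y ≢ z
2≤∣p∣⇒∃-distinct p 2≤∣p∣
  with y , y∈p ← 0<∣p∣⇒Nonempty p (≤-trans (s≤s z≤n) 2≤∣p∣)
  with z , z∈p-y ← 0<∣p∣⇒Nonempty (p - y) (≤-pred (≤-trans 2≤∣p∣ (≤-reflexive (x∈p⇒∣p∣≡1+∣p-x∣ y∈p))))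
  = y , z , y∈p , p─q⊆p p ⁅ y ⁆ z∈p-y , x∈p-y⇒x≢y z∈p-y ∘ sym

Family : ℕ → ℕ → Set
Family k m = Fin k → Subset m

neighbours : Family k m → Subset k → Subset m
neighbours {zero}  F []          = ⊥
neighbours {suc k} F (true ∷ S)  = F zero ∪ neighbours (F ∘ suc) S
neighbours {suc k} F (false ∷ S) = neighbours (F ∘ suc) S

∈-neighbours⁺ : (F : Family k m) (S : Subset k) {i : Fin k} {j : Fin m} →
                i ∈ S → j ∈ F i → j ∈ neighbours F S
∈-neighbours⁺ F (true ∷ S)  here         j∈ = x∈p∪q⁺ (inj₁ j∈)
∈-neighbours⁺ F (true ∷ S)  (there i∈S) j∈ = x∈p∪q⁺ (inj₂ (∈-neighbours⁺ (F ∘ suc) S i∈S j∈))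
∈-neighbours⁺ F (false ∷ S) (there i∈S) j∈ = ∈-neighbours⁺ (F ∘ suc) S i∈S j∈

∈-neighbours⁻ : (F : Family k m) (S : Subset k) {j : Fin m} →
                j ∈ neighbours F S → ∃ λ i → i ∈ S × j ∈ F i
∈-neighbours⁻ {zero}  F []          j∈ = ⊥-elim (∉⊥ j∈)
∈-neighbours⁻ {suc k} F (true ∷ S)  j∈ with x∈p∪q⁻ (F zero) _ j∈
... | inj₁ j∈F0 = zero , here , j∈F0
... | inj₂ j∈N  = let i , i∈S , j∈Fi = ∈-neighbours⁻ (F ∘ suc) S j∈N in suc i , there i∈S , j∈Fi
∈-neighbours⁻ {suc k} F (false ∷ S) j∈ =
  let i , i∈S , j∈Fi = ∈-neighbours⁻ (F ∘ suc) S j∈ in suc i , there i∈S , j∈Fi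

neighbours-least : (F : Family k m) (S : Subset k) {T : Subset m} →
                   (∀ {i j} → i ∈ S → j ∈ F i → j ∈ T) → neighbours F S ⊆ T
neighbours-least F S F[S]⊆T j∈ = let i , i∈S , j∈Fi = ∈-neighbours⁻ F S j∈ in F[S]⊆T i∈S j∈Fi

neighbours-⊥ : (F : Family k m) → neighbours F ⊥ ≡ ⊥
neighbours-⊥ {zero}  F = refl
neighbours-⊥ {suc k} F = neighbours-⊥ (F ∘ suc)

neighbours-⁅⁆ : (F : Family k m) (x : Fin k) → neighbours F ⁅ x ⁆ ≡ F x
neighbours-⁅⁆ F zero    = trans (cong (F zero ∪_) (neighbours-⊥ (F ∘ suc))) (∪-identityʳ (F zero))
neighbours-⁅⁆ F (suc x) = neighbours-⁅⁆ (F ∘ suc) x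

-- Hall's theorem, by Rado's edge-deletion argument

HallCondition : Family k m → Set
HallCondition F = ∀ S → ∣ S ∣ ≤ ∣ neighbours F S ∣

Deficient : Family k m → Subset k → Set
Deficient F S = ∣ neighbours F S ∣ < ∣ S ∣

Transversal : Family k m → Set
Transversal {k} {m} F = Σ (Fin k → Fin m) λ f → (∀ i → f i ∈ F i) × Injective _≡_ _≡_ f

hall-or-deficient : (F : Family k m) → HallCondition F ⊎ ∃ (Deficient F)
hall-or-deficient F with anySubset? (λ S → ∣ neighbours F S ∣ <? ∣ S ∣)
... | yes deficient = inj₂ deficient
... | no  ¬deficient = inj₁ λ S → ≮⇒≥ λ def → ¬deficient (S , def)

Transversal-mono : {F G : Family k m} → (∀ i → G i ⊆ F i) → Transversal G → Transversal F
Transversal-mono G⊆F (f , f∈G , f-inj) = f , (λ i → G⊆F i (f∈G i)) , f-inj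

delete : Family k m → Fin k → Fin m → Family k m
delete F x y i with i Fin.≟ x
... | yes _ = F i - y
... | no  _ = F i

delete-⊆ : (F : Family k m) (x : Fin k) (y : Fin m) (i : Fin k) → delete F x y i ⊆ F i
delete-⊆ F x y i with i Fin.≟ x
... | yes _ = p─q⊆p (F i) ⁅ y ⁆
... | no  _ = λ j∈ → j∈

∈-delete⁺ : (F : Family k m) {x i : Fin k} {y j : Fin m} →
            j ∈ F i → (i ≡ x → j ≢ y) → j ∈ delete F x y i
∈-delete⁺ F {x} {i} j∈ keep with i Fin.≟ x
... | yes i≡x = x∈p∧x≢y⇒x∈p-y j∈ (keep i≡x)
... | no  _   = j∈

∣delete∣<∣F∣ : (F : Family k m) {x : Fin k} {y : Fin m} → y ∈ F x → ∣ delete F x y x ∣ < ∣ F x ∣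
∣delete∣<∣F∣ F {x} y∈ with x Fin.≟ x
... | yes _   = x∈p⇒∣p-x∣<∣p∣ y∈
... | no  x≢x = contradiction refl x≢x

size : Family k m → ℕ
size {zero}  F = 0
size {suc k} F = ∣ F zero ∣ + size (F ∘ suc)

size-mono-≤ : (F G : Family k m) → (∀ i → ∣ G i ∣ ≤ ∣ F i ∣) → size G ≤ size F
size-mono-≤ {zero}  F G ≤F = z≤n
size-mono-≤ {suc k} F G ≤F = +-mono-≤ (≤F zero) (size-mono-≤ (F ∘ suc) (G ∘ suc) (≤F ∘ suc))

size-mono-< : (F G : Family k m) (x : Fin k) →
              (∀ i → ∣ G i ∣ ≤ ∣ F i ∣) → ∣ G x ∣ < ∣ F x ∣ → size G < size F
size-mono-< F G zero    ≤F <F = +-mono-<-≤ <F (size-mono-≤ (F ∘ suc) (G ∘ suc) (≤F ∘ suc))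
size-mono-< F G (suc x) ≤F <F = +-mono-≤-< (≤F zero) (size-mono-< (F ∘ suc) (G ∘ suc) x (≤F ∘ suc) <F)

size-delete< : (F : Family k m) {x : Fin k} {y : Fin m} → y ∈ F x → size (delete F x y) < size F
size-delete< F {x} {y} y∈ =
  size-mono-< F (delete F x y) x (λ i → p⊆q⇒∣p∣≤∣q∣ (delete-⊆ F x y i)) (∣delete∣<∣F∣ F y∈)

module _ {F : Family k m} (hall : HallCondition F) (x : Fin k) where

  deficient-after-delete⇒∋x : (y : Fin m) (A : Subset k) → Deficient (delete F x y) A → x ∈ A
  deficient-after-delete⇒∋x y A deficient with x ∈? A
  ... | yes x∈A = x∈A
  ... | no  x∉A = contradiction (≤-<-trans (hall A) (≤-<-trans (p⊆q⇒∣p∣≤∣q∣ N[A]⊆N′[A]) deficient)) (<-irrefl refl)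
    where
    N[A]⊆N′[A] : neighbours F A ⊆ neighbours (delete F x y) A
    N[A]⊆N′[A] = neighbours-least F A λ i∈A j∈ →
      ∈-neighbours⁺ (delete F x y) A i∈A (∈-delete⁺ F j∈ λ { refl → contradiction i∈A x∉A })

  -- Were both deletions to leave deficient sets A₁ and A₂ (both containing x), then
  -- N(A₁ ∪ A₂) ⊆ N₁ ∪ N₂ and N(A₁ ∩ A₂ - x) ⊆ N₁ ∩ N₂, so Hall's condition for F would give
  -- ∣ A₁ ∣ + ∣ A₂ ∣ - 1 ≤ ∣ N₁ ∣ + ∣ N₂ ∣ ≤ ∣ A₁ ∣ + ∣ A₂ ∣ - 2.
  delete-preserves-Hall : {y₁ y₂ : Fin m} → y₁ ≢ y₂ →
                          HallCondition (delete F x y₁) ⊎ HallCondition (delete F x y₂)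
  delete-preserves-Hall {y₁} {y₂} y₁≢y₂ with hall-or-deficient (delete F x y₁) | hall-or-deficient (delete F x y₂)
  ... | inj₁ hall₁        | _                 = inj₁ hall₁
  ... | inj₂ _            | inj₁ hall₂        = inj₂ hall₂
  ... | inj₂ (A₁ , def₁) | inj₂ (A₂ , def₂) = contradiction ∣A₁∣+∣A₂∣<∣A₁∣+∣A₂∣ (<-irrefl refl)
    where
    open ≤-Reasoning
    F₁ F₂ : Family k m
    F₁ = delete F x y₁
    F₂ = delete F x y₂

    N₁ N₂ : Subset m
    N₁ = neighbours F₁ A₁
    N₂ = neighbours F₂ A₂

    B : Subset k
    B = A₁ ∩ A₂ - x

    x∈A₁ : x ∈ A₁
    x∈A₁ = deficient-after-delete⇒∋x y₁ A₁ def₁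

    x∈A₂ : x ∈ A₂
    x∈A₂ = deficient-after-delete⇒∋x y₂ A₂ def₂

    N[A₁∪A₂]⊆N₁∪N₂ : neighbours F (A₁ ∪ A₂) ⊆ N₁ ∪ N₂
    N[A₁∪A₂]⊆N₁∪N₂ = neighbours-least F (A₁ ∪ A₂) λ {i} {j} i∈ j∈ → x∈p∪q⁺ (into i j i∈ j∈)
      where
      into : ∀ i j → i ∈ A₁ ∪ A₂ → j ∈ F i → j ∈ N₁ ⊎ j ∈ N₂
      into i j i∈ j∈ with i Fin.≟ x | j Fin.≟ y₁
      ... | yes refl | yes refl = inj₂ (∈-neighbours⁺ F₂ A₂ x∈A₂ (∈-delete⁺ F j∈ λ _ → y₁≢y₂))
      ... | yes refl | no j≢y₁  = inj₁ (∈-neighbours⁺ F₁ A₁ x∈A₁ (∈-delete⁺ F j∈ λ _ → j≢y₁))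
      ... | no i≢x   | _        with x∈p∪q⁻ A₁ A₂ i∈
      ...   | inj₁ i∈A₁ = inj₁ (∈-neighbours⁺ F₁ A₁ i∈A₁ (∈-delete⁺ F j∈ λ i≡x → contradiction i≡x i≢x))
      ...   | inj₂ i∈A₂ = inj₂ (∈-neighbours⁺ F₂ A₂ i∈A₂ (∈-delete⁺ F j∈ λ i≡x → contradiction i≡x i≢x))

    N[B]⊆N₁∩N₂ : neighbours F B ⊆ N₁ ∩ N₂
    N[B]⊆N₁∩N₂ = neighbours-least F B λ {i} {j} i∈B j∈ →
      let i∈A₁ , i∈A₂ = x∈p∩q⁻ A₁ A₂ (p─q⊆p (A₁ ∩ A₂) ⁅ x ⁆ i∈B)
          keep : ∀ {y} → i ≡ x → j ≢ y
          keep i≡x = contradiction i≡x (x∈p-y⇒x≢y i∈B)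
      in x∈p∩q⁺ ( ∈-neighbours⁺ F₁ A₁ i∈A₁ (∈-delete⁺ F j∈ keep)
                , ∈-neighbours⁺ F₂ A₂ i∈A₂ (∈-delete⁺ F j∈ keep))

    ∣A₁∣+∣A₂∣<∣A₁∣+∣A₂∣ : ∣ A₁ ∣ + ∣ A₂ ∣ < ∣ A₁ ∣ + ∣ A₂ ∣
    ∣A₁∣+∣A₂∣<∣A₁∣+∣A₂∣ = begin-strict
      ∣ A₁ ∣ + ∣ A₂ ∣               ≡⟨ ∣p∪q∣+∣p∩q∣≡∣p∣+∣q∣ A₁ A₂ ⟨
      ∣ A₁ ∪ A₂ ∣ + ∣ A₁ ∩ A₂ ∣    ≡⟨ cong (∣ A₁ ∪ A₂ ∣ +_) (x∈p⇒∣p∣≡1+∣p-x∣ (x∈p∩q⁺ (x∈A₁ , x∈A₂))) ⟩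
      ∣ A₁ ∪ A₂ ∣ + suc ∣ B ∣       ≤⟨ +-mono-≤ (≤-trans (hall (A₁ ∪ A₂)) (p⊆q⇒∣p∣≤∣q∣ N[A₁∪A₂]⊆N₁∪N₂))
                                              (s≤s (≤-trans (hall B) (p⊆q⇒∣p∣≤∣q∣ N[B]⊆N₁∩N₂))) ⟩
      ∣ N₁ ∪ N₂ ∣ + suc ∣ N₁ ∩ N₂ ∣ ≡⟨ +-suc _ _ ⟩
      suc (∣ N₁ ∪ N₂ ∣ + ∣ N₁ ∩ N₂ ∣) ≡⟨ cong suc (∣p∪q∣+∣p∩q∣≡∣p∣+∣q∣ N₁ N₂) ⟩
      suc (∣ N₁ ∣ + ∣ N₂ ∣)         <⟨ s≤s (≤-reflexive (sym (+-suc ∣ N₁ ∣ ∣ N₂ ∣))) ⟩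
      suc ∣ N₁ ∣ + suc ∣ N₂ ∣       ≤⟨ +-mono-≤ def₁ def₂ ⟩
      ∣ A₁ ∣ + ∣ A₂ ∣               ∎

singleton-rows⇒Transversal : (F : Family k m) → HallCondition F → (∀ x → ∣ F x ∣ ≤ 1) → Transversal F
singleton-rows⇒Transversal {k} {m} F hall ∣F∣≤1 = f , f∈F , f-injective
  where
  nonempty : ∀ x → Nonempty (F x)
  nonempty x = 0<∣p∣⇒Nonempty (F x) (begin-strict
    0                         <⟨ s≤s z≤n ⟩
    1                         ≡⟨ ∣⁅x⁆∣≡1 x ⟨
    ∣ ⁅ x ⁆ ∣                 ≤⟨ hall ⁅ x ⁆ ⟩
    ∣ neighbours F ⁅ x ⁆ ∣    ≡⟨ cong ∣_∣ (neighbours-⁅⁆ F x) ⟩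
    ∣ F x ∣                   ∎)
    where open ≤-Reasoning

  f : Fin k → Fin m
  f x = proj₁ (nonempty x)

  f∈F : ∀ x → f x ∈ F x
  f∈F x = proj₂ (nonempty x)

  f-injective : Injective _≡_ _≡_ f
  f-injective {a} {b} fa≡fb with a Fin.≟ b
  ... | yes a≡b = a≡b
  ... | no  a≢b = contradiction (hall (⁅ a ⁆ ∪ ⁅ b ⁆)) (<⇒≱ (begin-strict
    ∣ neighbours F (⁅ a ⁆ ∪ ⁅ b ⁆) ∣ ≤⟨ p⊆q⇒∣p∣≤∣q∣ N[a,b]⊆⁅fa⁆ ⟩
    ∣ ⁅ f a ⁆ ∣                     ≡⟨ ∣⁅x⁆∣≡1 (f a) ⟩
    1                               ≡⟨ ∣⁅x⁆∣≡1 a ⟨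
    ∣ ⁅ a ⁆ ∣                       <⟨ p⊂q⇒∣p∣<∣q∣ ⁅a⁆⊂⁅a⁆∪⁅b⁆ ⟩
    ∣ ⁅ a ⁆ ∪ ⁅ b ⁆ ∣               ∎))
    where
    open ≤-Reasoning
    ⁅a⁆⊂⁅a⁆∪⁅b⁆ : ⁅ a ⁆ ⊂ ⁅ a ⁆ ∪ ⁅ b ⁆
    ⁅a⁆⊂⁅a⁆∪⁅b⁆ = p⊆p∪q ⁅ b ⁆ , b , x∈p∪q⁺ (inj₂ (x∈⁅x⁆ b)) , x≢y⇒x∉⁅y⁆ (a≢b ∘ sym)

    j∈F[i]⇒j≡f[i] : ∀ {i j} → j ∈ F i → j ≡ f i
    j∈F[i]⇒j≡f[i] {i} j∈ = ∣p∣≤1⇒x∈p⇒y∈p⇒x≡y (∣F∣≤1 i) j∈ (f∈F i)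

    N[a,b]⊆⁅fa⁆ : neighbours F (⁅ a ⁆ ∪ ⁅ b ⁆) ⊆ ⁅ f a ⁆
    N[a,b]⊆⁅fa⁆ = neighbours-least F (⁅ a ⁆ ∪ ⁅ b ⁆) λ {i} i∈ j∈ →
      subst (_∈ ⁅ f a ⁆) (sym (trans (j∈F[i]⇒j≡f[i] j∈) (i∈⇒f[i]≡f[a] (x∈p∪q⁻ ⁅ a ⁆ ⁅ b ⁆ i∈)))) (x∈⁅x⁆ (f a))
      where
      i∈⇒f[i]≡f[a] : ∀ {i} → i ∈ ⁅ a ⁆ ⊎ i ∈ ⁅ b ⁆ → f i ≡ f a
      i∈⇒f[i]≡f[a] (inj₁ i∈⁅a⁆) = cong f (x∈⁅y⁆⇒x≡y a i∈⁅a⁆)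
      i∈⇒f[i]≡f[a] (inj₂ i∈⁅b⁆) = trans (cong f (x∈⁅y⁆⇒x≡y b i∈⁅b⁆)) (sym fa≡fb)

hall-theorem : (F : Family k m) → HallCondition F → Transversal F
hall-theorem F = go F (<-wellFounded (size F))
  where
  go : (F : Family k m) → Acc _<_ (size F) → HallCondition F → Transversal F
  go F (acc smaller) hall with Fin.any? (λ x → 2 ≤? ∣ F x ∣)
  ... | no ¬big = singleton-rows⇒Transversal F hall λ x → ≤-pred (≰⇒> (¬big ∘ (x ,_)))
  ... | yes (x , big) with y₁ , y₂ , y₁∈ , y₂∈ , y₁≢y₂ ← 2≤∣p∣⇒∃-distinct (F x) big
                      with delete-preserves-Hall hall x y₁≢y₂
  ... | inj₁ hall₁ = Transversal-mono (delete-⊆ F x y₁) (go _ (smaller (size-delete< F y₁∈)) hall₁)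
  ... | inj₂ hall₂ = Transversal-mono (delete-⊆ F x y₂) (go _ (smaller (size-delete< F y₂∈)) hall₂)

injective⇒surjective : (f : Fin n → Fin n) → Injective _≡_ _≡_ f → ∀ y → ∃ λ x → f x ≡ y
injective⇒surjective {suc n} f f-injective y with Fin.any? (λ x → f x Fin.≟ y)
... | yes hit  = hit
... | no  miss = contradiction (Fin.injective⇒≤ g-injective) 1+n≰n
  where
  y≢f : ∀ x → y ≢ f x
  y≢f x = miss ∘ (x ,_) ∘ sym

  g : Fin (suc n) → Fin n
  g x = punchOut (y≢f x)

  g-injective : Injective _≡_ _≡_ g
  g-injective {a} {b} = f-injective ∘ Fin.punchOut-injective (y≢f a) (y≢f b)

injective⇒permutation : (f : Fin n → Fin n) → Injective _≡_ _≡_ f →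
                        Σ (Permutation′ n) λ π → ∀ i → π ⟨$⟩ʳ i ≡ f i
injective⇒permutation {n} f f-injective = permutation f f⁻¹ f∘f⁻¹ f⁻¹∘f , λ _ → refl
  where
  f⁻¹ : Fin n → Fin n
  f⁻¹ y = proj₁ (injective⇒surjective f f-injective y)

  f∘f⁻¹ : ∀ y → f (f⁻¹ y) ≡ y
  f∘f⁻¹ y = proj₂ (injective⇒surjective f f-injective y)

  f⁻¹∘f : ∀ x → f⁻¹ (f x) ≡ x
  f⁻¹∘f x = f-injective (f∘f⁻¹ (f x))

-- Graphs with surplus are elementary

Surplus : Family n n → Set
Surplus {n} F = ∀ S → 0 < ∣ S ∣ → ∣ S ∣ < n → ∣ S ∣ < ∣ neighbours F S ∣

Surplus⇒∣S∣≤∣N[S]-j∣ : {F : Family n n} → Surplus F →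
                        {x : Fin n} {S : Subset n} → x ∉ S → (j : Fin n) → ∣ S ∣ ≤ ∣ neighbours F S - j ∣
Surplus⇒∣S∣≤∣N[S]-j∣ {F = F} surplus {S = S} x∉S j with nonempty? S
... | no  empty       = ≤-trans (≤-reflexive (Empty⇒∣p∣≡0 empty)) z≤n
... | yes (_ , y∈S) = ≤-pred (≤-trans (surplus S (x∈p⇒0<∣p∣ y∈S) (x∉p⇒∣p∣<n x∉S)) (∣p∣≤1+∣p-x∣ j (neighbours F S)))

-- When j₀ ∈ F i₀, the transversals of pin F i₀ j₀ are those of F that match i₀ to j₀.
pin : Family k m → Fin k → Fin m → Family k m
pin F i₀ j₀ i with i Fin.≟ i₀
... | yes _ = ⁅ j₀ ⁆
... | no  _ = F i - j₀

pin-at : (F : Family k m) (i₀ : Fin k) (j₀ : Fin m) → pin F i₀ j₀ i₀ ≡ ⁅ j₀ ⁆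
pin-at F i₀ j₀ with i₀ Fin.≟ i₀
... | yes _     = refl
... | no  i₀≢i₀ = contradiction refl i₀≢i₀

pin-⊆ : (F : Family k m) {i₀ : Fin k} {j₀ : Fin m} → j₀ ∈ F i₀ → ∀ i → pin F i₀ j₀ i ⊆ F i
pin-⊆ F {i₀} {j₀} j₀∈ i with i Fin.≟ i₀
... | yes refl = λ j∈ → subst (_∈ F i) (sym (x∈⁅y⁆⇒x≡y j₀ j∈)) j₀∈
... | no  _    = p─q⊆p (F i) ⁅ j₀ ⁆

∈-pin⁺ : (F : Family k m) {i₀ i : Fin k} {j₀ j : Fin m} → i ≢ i₀ → j ∈ F i → j ≢ j₀ → j ∈ pin F i₀ j₀ i
∈-pin⁺ F {i₀} {i} i≢i₀ j∈ j≢j₀ with i Fin.≟ i₀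
... | yes i≡i₀ = contradiction i≡i₀ i≢i₀
... | no  _    = x∈p∧x≢y⇒x∈p-y j∈ j≢j₀

neighbours-pin : (F : Family k m) {i₀ : Fin k} {j₀ : Fin m} {T S : Subset k} →
                 i₀ ∉ T → T ⊆ S → neighbours F T - j₀ ⊆ neighbours (pin F i₀ j₀) S
neighbours-pin F {i₀} {j₀} {T} {S} i₀∉T T⊆S j∈ with i , i∈T , j∈Fi ← ∈-neighbours⁻ F T (p─q⊆p _ ⁅ j₀ ⁆ j∈)
  = ∈-neighbours⁺ (pin F i₀ j₀) S (T⊆S i∈T)
      (∈-pin⁺ F (λ { refl → i₀∉T i∈T }) j∈Fi (x∈p-y⇒x≢y j∈))

Surplus⇒Hall-pin : {F : Family n n} → Surplus F → (i₀ j₀ : Fin n) → HallCondition (pin F i₀ j₀)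
Surplus⇒Hall-pin {n} {F} surplus i₀ j₀ S with i₀ ∈? S
... | no  i₀∉S = begin
  ∣ S ∣                       ≤⟨ Surplus⇒∣S∣≤∣N[S]-j∣ surplus i₀∉S j₀ ⟩
  ∣ neighbours F S - j₀ ∣     ≤⟨ p⊆q⇒∣p∣≤∣q∣ (neighbours-pin F i₀∉S ⊆-refl) ⟩
  ∣ neighbours F′ S ∣         ∎
  where
  open ≤-Reasoning
  F′ : Family n n
  F′ = pin F i₀ j₀
... | yes i₀∈S = begin
  ∣ S ∣                       ≡⟨ x∈p⇒∣p∣≡1+∣p-x∣ i₀∈S ⟩
  suc ∣ S - i₀ ∣              ≤⟨ s≤s (Surplus⇒∣S∣≤∣N[S]-j∣ surplus x∉p-x j₀) ⟩
  suc ∣ neighbours F (S - i₀) - j₀ ∣ ≤⟨ s≤s (p⊆q⇒∣p∣≤∣q∣ N[S-i₀]-j₀⊆N′[S]-j₀) ⟩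
  suc ∣ neighbours F′ S - j₀ ∣ ≡⟨ x∈p⇒∣p∣≡1+∣p-x∣ j₀∈N′[S] ⟨
  ∣ neighbours F′ S ∣         ∎
  where
  open ≤-Reasoning
  F′ : Family n n
  F′ = pin F i₀ j₀
  j₀∈N′[S] : j₀ ∈ neighbours F′ S
  j₀∈N′[S] = ∈-neighbours⁺ F′ S i₀∈S (subst (j₀ ∈_) (sym (pin-at F i₀ j₀)) (x∈⁅x⁆ j₀))
  N[S-i₀]-j₀⊆N′[S]-j₀ : neighbours F (S - i₀) - j₀ ⊆ neighbours F′ S - j₀
  N[S-i₀]-j₀⊆N′[S]-j₀ j∈ = x∈p∧x≢y⇒x∈p-y (neighbours-pin F x∉p-x (p─q⊆p S ⁅ i₀ ⁆) j∈) (x∈p-y⇒x≢y j∈)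

Surplus⇒edge-in-permutation : {F : Family n n} → Surplus F → {i₀ j₀ : Fin n} → j₀ ∈ F i₀ →
                              Σ (Permutation′ n) λ π → π ⟨$⟩ʳ i₀ ≡ j₀ × (∀ i → π ⟨$⟩ʳ i ∈ F i)
Surplus⇒edge-in-permutation {F = F} surplus {i₀} {j₀} j₀∈
  with f , f∈ , f-injective ← hall-theorem (pin F i₀ j₀) (Surplus⇒Hall-pin surplus i₀ j₀)
  with π , π≗f ← injective⇒permutation f f-injective
  = π
  , trans (π≗f i₀) (x∈⁅y⁆⇒x≡y j₀ (subst (f i₀ ∈_) (pin-at F i₀ j₀) (f∈ i₀)))
  , λ i → subst (_∈ F i) (sym (π≗f i)) (pin-⊆ F j₀∈ i (f∈ i))

rows : BipGraph n → Family n n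
rows G = lookup G

∈-rows⇒Edge : {G : BipGraph n} {i j : Fin n} → j ∈ rows G i → Edge G i j
∈-rows⇒Edge = []=⇒lookup

Edge⇒∈-rows : {G : BipGraph n} {i j : Fin n} → Edge G i j → j ∈ rows G i
Edge⇒∈-rows {G = G} {i} {j} = lookup⇒[]= j (lookup G i)

Surplus⇒Nonempty-row : {F : Family n n} → 1 < n → Surplus F → ∀ i → Nonempty (F i)
Surplus⇒Nonempty-row {F = F} 1<n surplus i = 0<∣p∣⇒Nonempty (F i) (begin-strict
  0                        <⟨ s≤s z≤n ⟩
  1                        ≡⟨ ∣⁅x⁆∣≡1 i ⟨
  ∣ ⁅ i ⁆ ∣                <⟨ surplus ⁅ i ⁆ (≤-reflexive (sym (∣⁅x⁆∣≡1 i))) (≤-trans (≤-reflexive (cong suc (∣⁅x⁆∣≡1 i))) 1<n) ⟩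
  ∣ neighbours F ⁅ i ⁆ ∣   ≡⟨ cong ∣_∣ (neighbours-⁅⁆ F i) ⟩
  ∣ F i ∣                  ∎)
  where open ≤-Reasoning

module _ {G : BipGraph n} (1<n : 1 < n) (surplus : Surplus (rows G)) where

  private
    matchingThrough : {i j : Fin n} → j ∈ rows G i → PerfectMatching n
    matchingThrough j∈ = proj₁ (Surplus⇒edge-in-permutation surplus j∈)

    matchingThrough-⊆ : {i j : Fin n} (j∈ : j ∈ rows G i) → ∀ a → Edge G a (matchingThrough j∈ ⟨$⟩ʳ a)
    matchingThrough-⊆ j∈ a = ∈-rows⇒Edge {G = G} (proj₂ (proj₂ (Surplus⇒edge-in-permutation surplus j∈)) a)

    -- Off the edges of G, any matching inside G serves as a placeholder.
    matchingAt : Fin n → Fin n → PerfectMatching n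
    matchingAt i j with j ∈? rows G i
    ... | yes j∈ = matchingThrough j∈
    ... | no  _  = matchingThrough (proj₂ (Surplus⇒Nonempty-row 1<n surplus i))

    matchingAt-⊆ : ∀ i j a → Edge G a (matchingAt i j ⟨$⟩ʳ a)
    matchingAt-⊆ i j with j ∈? rows G i
    ... | yes j∈ = matchingThrough-⊆ j∈
    ... | no  _  = matchingThrough-⊆ (proj₂ (Surplus⇒Nonempty-row 1<n surplus i))

    matchingAt-through : ∀ {i j} → Edge G i j → InMatching (matchingAt i j) i j
    matchingAt-through {i} {j} e with j ∈? rows G i
    ... | yes j∈ = proj₁ (proj₂ (Surplus⇒edge-in-permutation surplus j∈))
    ... | no  j∉ = contradiction (Edge⇒∈-rows {G = G} e) j∉

    matchings : List (PerfectMatching n)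
    matchings = map (uncurry matchingAt) (cartesianProduct (allFin n) (allFin n))

    Edge⇒Any : ∀ {i j} → Edge G i j → Any (λ π → InMatching π i j) matchings
    Edge⇒Any {i} {j} e = lose (∈-map⁺ (uncurry matchingAt) (∈-cartesianProduct⁺ (∈-allFin i) (∈-allFin j)))
                              (matchingAt-through e)

    Any⇒Edge : ∀ {i j} → Any (λ π → InMatching π i j) matchings → Edge G i j
    Any⇒Edge {i} any with π , π∈ , πi≡j ← find any with (a , b) , _ , refl ← ∈-map⁻ (uncurry matchingAt) π∈ =
      subst (Edge G i) πi≡j (matchingAt-⊆ a b i)

  Surplus⇒MatchingCovered : MatchingCovered G
  Surplus⇒MatchingCovered = matchings , matchings≢[] , λ i j → mk⇔ Edge⇒Any Any⇒Edge
    where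
    matchings≢[] : matchings ≢ []
    matchings≢[] matchings≡[] with j , j∈ ← Surplus⇒Nonempty-row 1<n surplus (fromℕ< 1<n)
      with () ← subst (Any _) matchings≡[] (Edge⇒Any (∈-rows⇒Edge {G = G} j∈))

_◅◅_ : {G : BipGraph n} {u v w : Vertex n} → Walk G u v → Walk G v w → Walk G u w
here       ◅◅ q = q
step uv p  ◅◅ q = step uv (p ◅◅ q)

module _ {G : BipGraph n} (surplus : Surplus (rows G)) where

  private
    F : Family n n
    F = rows G

    Reachable : Fin n → Subset n → Set
    Reachable a S = ∀ {b} → b ∈ S → Walk G (inj₁ a) (inj₁ b)

  -- If S and its complement had disjoint neighbourhoods, the surplus of both would give
  -- n = ∣ ∁ S ∣ + ∣ S ∣ < ∣ N (∁ S) ∣ + ∣ N S ∣ ≤ n.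
  Surplus⇒common-neighbour-across : {S : Subset n} {a b : Fin n} → a ∈ S → b ∉ S →
                                    ∃₂ λ i c → i ∈ S × c ∉ S × Nonempty (F i ∩ F c)
  Surplus⇒common-neighbour-across {S} {a} {b} a∈S b∉S
    with Fin.any? (λ c → ¬? (c ∈? S) ×-dec nonempty? (F c ∩ neighbours F S))
  ... | yes (c , c∉S , j , j∈) =
    let j∈Fc , j∈N[S] = x∈p∩q⁻ (F c) _ j∈
        i , i∈S , j∈Fi = ∈-neighbours⁻ F S j∈N[S]
    in i , c , i∈S , c∉S , j , x∈p∩q⁺ (j∈Fi , j∈Fc)
  ... | no closed = contradiction n<n (<-irrefl refl)
    where
    open ≤-Reasoning
    N[∁S]∩N[S]-empty : Empty (neighbours F (∁ S) ∩ neighbours F S)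
    N[∁S]∩N[S]-empty (j , j∈) =
      let j∈N[∁S] , j∈N[S] = x∈p∩q⁻ _ _ j∈
          c , c∈∁S , j∈Fc = ∈-neighbours⁻ F (∁ S) j∈N[∁S]
      in closed (c , x∈∁p⇒x∉p c∈∁S , j , x∈p∩q⁺ (j∈Fc , j∈N[S]))

    n<n : n < n
    n<n = begin-strict
      n                              ≡⟨ m∸n+n≡m (∣p∣≤n S) ⟨
      n ∸ ∣ S ∣ + ∣ S ∣              ≡⟨ cong (_+ ∣ S ∣) (∣∁p∣≡n∸∣p∣ S) ⟨
      ∣ ∁ S ∣ + ∣ S ∣                <⟨ +-mono-< (surplus (∁ S) (x∈p⇒0<∣p∣ (x∉p⇒x∈∁p b∉S)) (x∉p⇒∣p∣<n (x∈p⇒x∉∁p a∈S)))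
                                                 (surplus S (x∈p⇒0<∣p∣ a∈S) (x∉p⇒∣p∣<n b∉S)) ⟩
      ∣ N∁S ∣ + ∣ NS ∣               ≡⟨ ∣p∪q∣+∣p∩q∣≡∣p∣+∣q∣ N∁S NS ⟨
      ∣ N∁S ∪ NS ∣ + ∣ N∁S ∩ NS ∣    ≡⟨ cong (∣ N∁S ∪ NS ∣ +_) (Empty⇒∣p∣≡0 N[∁S]∩N[S]-empty) ⟩
      ∣ N∁S ∪ NS ∣ + 0               ≡⟨ +-identityʳ _ ⟩
      ∣ N∁S ∪ NS ∣                   ≤⟨ ∣p∣≤n (N∁S ∪ NS) ⟩
      n                              ∎
      where
      N∁S NS : Subset n
      N∁S = neighbours F (∁ S)
      NS  = neighbours F S

  private
    reachable-grows : (a : Fin n) (s : ℕ) →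
                      ∃ λ S → a ∈ S × Reachable a S × ((∀ b → b ∈ S) ⊎ s < ∣ S ∣)
    reachable-grows a zero =
      ⁅ a ⁆ , x∈⁅x⁆ a , (λ b∈ → subst (λ b → Walk G (inj₁ a) (inj₁ b)) (sym (x∈⁅y⁆⇒x≡y a b∈)) here)
            , inj₂ (≤-reflexive (sym (∣⁅x⁆∣≡1 a)))
    reachable-grows a (suc s) with reachable-grows a s
    ... | S , a∈S , reach , inj₁ full = S , a∈S , reach , inj₁ full
    ... | S , a∈S , reach , inj₂ s<∣S∣ with Fin.all? (_∈? S)
    ...   | yes full = S , a∈S , reach , inj₁ full
    ...   | no ¬full
            with b , b∉S ← Fin.¬∀⟶∃¬ n _ (_∈? S) ¬full
            with i , c , i∈S , c∉S , j , j∈ ← Surplus⇒common-neighbour-across a∈S b∉S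
            = S ∪ ⁅ c ⁆ , x∈p∪q⁺ (inj₁ a∈S) , reach′ , inj₂ (<-≤-trans (s≤s s<∣S∣) (p⊂q⇒∣p∣<∣q∣ S⊂S∪⁅c⁆))
      where
      S⊂S∪⁅c⁆ : S ⊂ S ∪ ⁅ c ⁆
      S⊂S∪⁅c⁆ = p⊆p∪q ⁅ c ⁆ , c , x∈p∪q⁺ (inj₂ (x∈⁅x⁆ c)) , c∉S

      reach-c : Walk G (inj₁ a) (inj₁ c)
      reach-c = let j∈Fi , j∈Fc = x∈p∩q⁻ (F i) (F c) j∈ in
        reach i∈S ◅◅ step (lr (∈-rows⇒Edge {G = G} j∈Fi)) (step (rl (∈-rows⇒Edge {G = G} j∈Fc)) here)

      reach′ : Reachable a (S ∪ ⁅ c ⁆)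
      reach′ b∈ with x∈p∪q⁻ S ⁅ c ⁆ b∈
      ... | inj₁ b∈S   = reach b∈S
      ... | inj₂ b∈⁅c⁆ = subst (λ b → Walk G (inj₁ a) (inj₁ b)) (sym (x∈⁅y⁆⇒x≡y c b∈⁅c⁆)) reach-c

  Surplus⇒left-connected : (a b : Fin n) → Walk G (inj₁ a) (inj₁ b)
  Surplus⇒left-connected a b with reachable-grows a n
  ... | S , _ , reach , inj₁ full  = reach (full b)
  ... | S , _ , _     , inj₂ n<∣S∣ = contradiction (∣p∣≤n S) (<⇒≱ n<∣S∣)

  Surplus⇒Nonempty-column : 1 < n → (j : Fin n) → ∃ λ i → j ∈ F i
  Surplus⇒Nonempty-column 1<n j = let i , i∈ , j∈Fi = ∈-neighbours⁻ F S j∈N[S] in i , j∈Fi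
    where
    S : Subset n
    S = ⊤ - j
    ∣⊤∣≡1+∣S∣ : n ≡ suc ∣ S ∣
    ∣⊤∣≡1+∣S∣ = trans (sym (∣⊤∣≡n n)) (x∈p⇒∣p∣≡1+∣p-x∣ {p = ⊤ {n}} ∈⊤)
    n≤∣N[S]∣ : n ≤ ∣ neighbours F S ∣
    n≤∣N[S]∣ = subst (_≤ ∣ neighbours F S ∣) (sym ∣⊤∣≡1+∣S∣)
      (surplus S (≤-pred (subst (1 <_) ∣⊤∣≡1+∣S∣ 1<n)) (≤-reflexive (sym ∣⊤∣≡1+∣S∣)))
    j∈N[S] : j ∈ neighbours F S
    j∈N[S] = subst (j ∈_) (sym (∣p∣≡n⇒p≡⊤ (≤-antisym (∣p∣≤n (neighbours F S)) n≤∣N[S]∣))) ∈⊤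

  private
    walk-from-left : 1 < n → (a : Fin n) (v : Vertex n) → Walk G (inj₁ a) v
    walk-from-left 1<n a (inj₁ b) = Surplus⇒left-connected a b
    walk-from-left 1<n a (inj₂ j) =
      let i , j∈Fi = Surplus⇒Nonempty-column 1<n j in
      Surplus⇒left-connected a i ◅◅ step (lr (∈-rows⇒Edge {G = G} j∈Fi)) here

  Surplus⇒Connected : 1 < n → Connected G
  Surplus⇒Connected 1<n (inj₁ a) v = walk-from-left 1<n a v
  Surplus⇒Connected 1<n (inj₂ j) v =
    let i , j∈Fi = Surplus⇒Nonempty-column 1<n j in
    step (rl (∈-rows⇒Edge {G = G} j∈Fi)) (walk-from-left 1<n i v)

Surplus⇒Elementary : {G : BipGraph n} → 1 < n → Surplus (rows G) → Elementary G
Surplus⇒Elementary {G = G} 1<n surplus =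
  Surplus⇒Connected {G = G} surplus 1<n , Surplus⇒MatchingCovered {G = G} 1<n surplus

-- Counting with decidable predicates

count : {A : Set} {P : Pred A 0ℓ} → Decidable P → List A → ℕ
count P? xs = length (filter P? xs)

module _ {A : Set} {P : Pred A 0ℓ} (P? : Decidable P) where

  count-++ : (xs ys : List A) → count P? (xs ++ ys) ≡ count P? xs + count P? ys
  count-++ xs ys = trans (cong length (filter-++ P? xs ys)) (length-++ (filter P? xs))

  count-map : {B : Set} (f : B → A) (xs : List B) → count P? (map f xs) ≡ count (P? ∘ f) xs
  count-map f []       = refl
  count-map f (x ∷ xs) with does (P? (f x))
  ... | true  = cong suc (count-map f xs)
  ... | false = count-map f xs

  count-none : (∀ {x} → ¬ P x) → (xs : List A) → count P? xs ≡ 0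
  count-none ¬P []       = refl
  count-none ¬P (x ∷ xs) with P? x
  ... | yes Px = contradiction Px ¬P
  ... | no  _  = count-none ¬P xs

  count-cong : {Q : Pred A 0ℓ} (Q? : Decidable Q) → (∀ {x} → P x ⇔ Q x) → (xs : List A) → count P? xs ≡ count Q? xs
  count-cong Q? P⇔Q xs = cong length (filter-≐ P? Q? (Equivalence.to P⇔Q , Equivalence.from P⇔Q) xs)

  count+count-¬≡length : (xs : List A) → count P? xs + count (¬? ∘ P?) xs ≡ length xs
  count+count-¬≡length []       = refl
  count+count-¬≡length (x ∷ xs) with P? x
  ... | yes _ = cong suc (count+count-¬≡length xs)
  ... | no  _ = trans (+-suc _ _) (cong suc (count+count-¬≡length xs))

  count-mono : {Q : Pred A 0ℓ} (Q? : Decidable Q) → (∀ {x} → P x → Q x) → (xs : List A) → count P? xs ≤ count Q? xs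
  count-mono Q? P⊆Q []       = z≤n
  count-mono Q? P⊆Q (x ∷ xs) with ih ← count-mono Q? P⊆Q xs | P? x | Q? x
  ... | yes _  | yes _ = s≤s ih
  ... | yes Px | no ¬Q = contradiction (P⊆Q Px) ¬Q
  ... | no _   | yes _ = m≤n⇒m≤1+n ih
  ... | no _   | no _  = ih

  count-⊎-≤ : {Q R : Pred A 0ℓ} (Q? : Decidable Q) (R? : Decidable R) → (∀ {x} → P x → Q x ⊎ R x) →
              (xs : List A) → count P? xs ≤ count Q? xs + count R? xs
  count-⊎-≤ Q? R? P⊆Q∪R []       = z≤n
  count-⊎-≤ Q? R? P⊆Q∪R (x ∷ xs) with ih ← count-⊎-≤ Q? R? P⊆Q∪R xs | P? x | Q? x | R? x
  ... | yes _  | yes _ | yes _ = s≤s (≤-trans ih (+-monoʳ-≤ _ (n≤1+n _)))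
  ... | yes _  | yes _ | no _  = s≤s ih
  ... | yes _  | no _  | yes _ = ≤-trans (s≤s ih) (≤-reflexive (sym (+-suc _ _)))
  ... | yes Px | no ¬Q | no ¬R = contradiction (P⊆Q∪R Px) [ ¬Q , ¬R ]′
  ... | no _   | yes _ | yes _ = m≤n⇒m≤1+n (≤-trans ih (+-monoʳ-≤ _ (n≤1+n _)))
  ... | no _   | yes _ | no _  = m≤n⇒m≤1+n ih
  ... | no _   | no _  | yes _ = ≤-trans ih (+-monoʳ-≤ _ (n≤1+n _))
  ... | no _   | no _  | no _  = ih

count-union-bound : {A B : Set} {P : Pred A 0ℓ} {Q : B → Pred A 0ℓ} (P? : Decidable P) (Q? : ∀ e → Decidable (Q e))
                    (xs : List A) (es : List B) {w c : ℕ} →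
                    (∀ {x} → P x → Any (λ e → Q e x) es) → (∀ {e} → e ∈ₗ es → count (Q? e) xs * w ≤ c) →
                    count P? xs * w ≤ length es * c
count-union-bound P? Q? xs [] covered bound =
  ≤-reflexive (cong (_* _) (count-none P? (¬Any[] ∘ covered) xs))
count-union-bound {A} {P = P} {Q} P? Q? xs (e ∷ es) {w} {c} covered bound = begin
  count P? xs * w                          ≤⟨ *-monoˡ-≤ w (count-⊎-≤ P? (Q? e) P′? split xs) ⟩
  (count (Q? e) xs + count P′? xs) * w     ≡⟨ *-distribʳ-+ w (count (Q? e) xs) _ ⟩
  count (Q? e) xs * w + count P′? xs * w   ≤⟨ +-mono-≤ (bound (here refl)) (count-union-bound P′? Q? xs es covered′ (bound ∘ there)) ⟩
  c + length es * c                        ∎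
  where
  open ≤-Reasoning

  P′ : Pred A 0ℓ
  P′ x = P x × ¬ Q e x

  P′? : Decidable P′
  P′? x = P? x ×-dec ¬? (Q? e x)

  split : ∀ {x} → P x → Q e x ⊎ P′ x
  split {x} Px with Q? e x
  ... | yes Qx = inj₁ Qx
  ... | no ¬Qx = inj₂ (Px , ¬Qx)

  covered′ : ∀ {x} → P′ x → Any (λ e′ → Q e′ x) es
  covered′ (Px , ¬Qx) with covered Px
  ... | here Qx      = contradiction Qx ¬Qx
  ... | there Any-es = Any-es

count-cartesianProductWith : {A B C : Set} {P : Pred A 0ℓ} {Q : Pred B 0ℓ} {R : Pred C 0ℓ}
                             (P? : Decidable P) (Q? : Decidable Q) (R? : Decidable R) (f : A → B → C) →
                             (∀ {x y} → R (f x y) ⇔ (P x × Q y)) → (xs : List A) (ys : List B) →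
                             count R? (cartesianProductWith f xs ys) ≡ count P? xs * count Q? ys
count-cartesianProductWith P? Q? R? f R⇔P×Q []       ys = refl
count-cartesianProductWith P? Q? R? f R⇔P×Q (x ∷ xs) ys = begin
  count R? (map (f x) ys ++ cartesianProductWith f xs ys)    ≡⟨ count-++ R? (map (f x) ys) _ ⟩
  count R? (map (f x) ys) + count R? (cartesianProductWith f xs ys)
    ≡⟨ cong₂ _+_ (count-map R? (f x) ys) (count-cartesianProductWith P? Q? R? f R⇔P×Q xs ys) ⟩
  count (R? ∘ f x) ys + count P? xs * count Q? ys           ≡⟨ row ⟩
  count P? (x ∷ xs) * count Q? ys                           ∎
  where
  open ≡-Reasoning
  open Equivalence
  row : count (R? ∘ f x) ys + count P? xs * count Q? ys ≡ count P? (x ∷ xs) * count Q? ys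
  row with P? x
  ... | yes Px = cong (_+ _) (count-cong (R? ∘ f x) Q? (mk⇔ (proj₂ ∘ to R⇔P×Q) (λ Qy → from R⇔P×Q (Px , Qy))) ys)
  ... | no ¬Px = cong (_+ _) (count-none (R? ∘ f x) (¬Px ∘ proj₁ ∘ to R⇔P×Q) ys)

length-cartesianProductWith : {A B C : Set} (f : A → B → C) (xs : List A) (ys : List B) →
                              length (cartesianProductWith f xs ys) ≡ length xs * length ys
length-cartesianProductWith f []       ys = refl
length-cartesianProductWith f (x ∷ xs) ys = trans (length-++ (map (f x) ys))
  (cong₂ _+_ (length-map (f x) ys) (length-cartesianProductWith f xs ys))

allVecs : {A : Set} → List A → (k : ℕ) → List (Vec A k)
allVecs xs zero    = [] ∷ []
allVecs xs (suc k) = cartesianProductWith _∷_ xs (allVecs xs k)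

length-allVecs : {A : Set} (xs : List A) (k : ℕ) → length (allVecs xs k) ≡ length xs ^ k
length-allVecs xs zero    = refl
length-allVecs xs (suc k) =
  trans (length-cartesianProductWith _∷_ xs (allVecs xs k)) (cong (length xs *_) (length-allVecs xs k))

∈-allVecs : {A : Set} {xs : List A} → (∀ x → x ∈ₗ xs) → (v : Vec A k) → v ∈ₗ allVecs xs k
∈-allVecs ∈xs []      = here refl
∈-allVecs ∈xs (x ∷ v) = ∈-cartesianProductWith⁺ _∷_ (∈xs x) (∈-allVecs ∈xs v)

allVecs-Unique : {A : Set} {xs : List A} → Unique xs → (k : ℕ) → Unique (allVecs xs k)
allVecs-Unique unique zero    = All.[] ∷ []
allVecs-Unique unique (suc k) = Unique.cartesianProductWith⁺ _∷_ ∷-injective unique (allVecs-Unique unique k)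

AllOn : {A : Set} → Pred A 0ℓ → Subset k → Pred (Vec A k) 0ℓ
AllOn P []          []      = Unit
AllOn P (true ∷ S)  (x ∷ v) = P x × AllOn P S v
AllOn P (false ∷ S) (x ∷ v) = AllOn P S v

allOn? : {A : Set} {P : Pred A 0ℓ} → Decidable P → (S : Subset k) → Decidable (AllOn P S)
allOn? P? []          []      = yes tt
allOn? P? (true ∷ S)  (x ∷ v) = P? x ×-dec allOn? P? S v
allOn? P? (false ∷ S) (x ∷ v) = allOn? P? S v

AllOn⁺ : {A : Set} {P : Pred A 0ℓ} (S : Subset k) (v : Vec A k) → (∀ {i} → i ∈ S → P (lookup v i)) → AllOn P S v
AllOn⁺ []          []      _    = tt
AllOn⁺ (true ∷ S)  (x ∷ v) P[v] = P[v] here , AllOn⁺ S v (P[v] ∘ there)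
AllOn⁺ (false ∷ S) (x ∷ v) P[v] = AllOn⁺ S v (P[v] ∘ there)

-- Each coordinate in S independently falls into P, which happens for at most a 1/w fraction of xs.
count-AllOn : {A : Set} {P : Pred A 0ℓ} (P? : Decidable P) (xs : List A) {w : ℕ} →
              count P? xs * w ≤ length xs → (S : Subset k) →
              count (allOn? P? S) (allVecs xs k) * w ^ ∣ S ∣ ≤ length xs ^ k
count-AllOn P? xs {w} c*w≤ [] = ≤-refl
count-AllOn {k = suc k} P? xs {w} c*w≤ (true ∷ S) = begin
  count (allOn? P? (true ∷ S)) (allVecs xs (suc k)) * (w * w ^ ∣ S ∣)
    ≡⟨ cong (_* _) (count-cartesianProductWith P? (allOn? P? S) (allOn? P? (true ∷ S)) _∷_ (mk⇔ id id) xs _) ⟩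
  count P? xs * count (allOn? P? S) (allVecs xs k) * (w * w ^ ∣ S ∣)
    ≡⟨ [m*n]*[o*p]≡[m*o]*[n*p] (count P? xs) _ w _ ⟩
  count P? xs * w * (count (allOn? P? S) (allVecs xs k) * w ^ ∣ S ∣)
    ≤⟨ *-mono-≤ c*w≤ (count-AllOn P? xs c*w≤ S) ⟩
  length xs * length xs ^ k ∎
  where open ≤-Reasoning
count-AllOn {k = suc k} P? xs {w} c*w≤ (false ∷ S) = begin
  count (allOn? P? (false ∷ S)) (allVecs xs (suc k)) * w ^ ∣ S ∣
    ≡⟨ cong (_* _) (count-cartesianProductWith (λ _ → yes tt) (allOn? P? S) (allOn? P? (false ∷ S)) _∷_ (mk⇔ (tt ,_) proj₂) xs _) ⟩
  count (λ _ → yes tt) xs * count (allOn? P? S) (allVecs xs k) * w ^ ∣ S ∣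
    ≡⟨ cong (λ c → c * count (allOn? P? S) (allVecs xs k) * w ^ ∣ S ∣) (cong length (filter-all _ (All.universal (λ _ → tt) xs))) ⟩
  length xs * count (allOn? P? S) (allVecs xs k) * w ^ ∣ S ∣
    ≡⟨ *-assoc (length xs) _ _ ⟩
  length xs * (count (allOn? P? S) (allVecs xs k) * w ^ ∣ S ∣)
    ≤⟨ *-monoʳ-≤ (length xs) (count-AllOn P? xs c*w≤ S) ⟩
  length xs * length xs ^ k ∎
  where open ≤-Reasoning

allSubsets : (n : ℕ) → List (Subset n)
allSubsets = allVecs (true ∷ false ∷ [])

allGraphs : (n : ℕ) → List (BipGraph n)
allGraphs n = allVecs (allSubsets n) n

∈-allSubsets : (p : Subset n) → p ∈ₗ allSubsets n
∈-allSubsets = ∈-allVecs λ { true → here refl ; false → there (here refl) }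

allSubsets-Unique : (n : ℕ) → Unique (allSubsets n)
allSubsets-Unique = allVecs-Unique (((λ ()) All.∷ All.[]) ∷ All.[] ∷ [])

length-allSubsets : (n : ℕ) → length (allSubsets n) ≡ 2 ^ n
length-allSubsets = length-allVecs (true ∷ false ∷ [])

allGraphs-Unique : (n : ℕ) → Unique (allGraphs n)
allGraphs-Unique n = allVecs-Unique (allSubsets-Unique n) n

length-allGraphs : (n : ℕ) → length (allGraphs n) ≡ 2 ^ (n * n)
length-allGraphs n = trans (length-allVecs (allSubsets n) n) (trans (cong (_^ n) (length-allSubsets n)) (^-*-assoc 2 n n))

count-allSubsets-suc : {P : Pred (Subset (suc n)) 0ℓ} (P? : Decidable P) →
                       count P? (allSubsets (suc n)) ≡ count (P? ∘ (true ∷_)) (allSubsets n) + count (P? ∘ (false ∷_)) (allSubsets n)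
count-allSubsets-suc {n} P? = begin
  count P? (map (true ∷_) L ++ map (false ∷_) L ++ [])   ≡⟨ count-++ P? (map (true ∷_) L) _ ⟩
  count P? (map (true ∷_) L) + count P? (map (false ∷_) L ++ [])
    ≡⟨ cong (λ xs → count P? (map (true ∷_) L) + count P? xs) (++-identityʳ (map (false ∷_) L)) ⟩
  count P? (map (true ∷_) L) + count P? (map (false ∷_) L)
    ≡⟨ cong₂ _+_ (count-map P? (true ∷_) L) (count-map P? (false ∷_) L) ⟩
  count (P? ∘ (true ∷_)) L + count (P? ∘ (false ∷_)) L    ∎
  where
  open ≡-Reasoning
  L : List (Subset n)
  L = allSubsets n

count-small-subsets : (n k : ℕ) → count (λ T → ∣ T ∣ ≤? k) (allSubsets n) ≤ suc n ^ k
count-small-subsets zero    k       = ≤-reflexive (sym (^-zeroˡ k))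
count-small-subsets (suc n) zero    = begin
  count (λ T → ∣ T ∣ ≤? 0) (allSubsets (suc n))           ≡⟨ count-allSubsets-suc {n} (λ T → ∣ T ∣ ≤? 0) ⟩
  count (λ T → suc ∣ T ∣ ≤? 0) (allSubsets n) + count (λ T → ∣ T ∣ ≤? 0) (allSubsets n)
    ≡⟨ cong (_+ count (λ T → ∣ T ∣ ≤? 0) (allSubsets n)) (count-none (λ T → suc ∣ T ∣ ≤? 0) (λ ()) (allSubsets n)) ⟩
  count (λ T → ∣ T ∣ ≤? 0) (allSubsets n)                 ≤⟨ count-small-subsets n 0 ⟩
  1                                                       ∎
  where open ≤-Reasoning
count-small-subsets (suc n) (suc k) = begin
  count (λ T → ∣ T ∣ ≤? suc k) (allSubsets (suc n))       ≡⟨ count-allSubsets-suc {n} (λ T → ∣ T ∣ ≤? suc k) ⟩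
  count (λ T → suc ∣ T ∣ ≤? suc k) (allSubsets n) + count (λ T → ∣ T ∣ ≤? suc k) (allSubsets n)
    ≡⟨ cong (_+ count (λ T → ∣ T ∣ ≤? suc k) (allSubsets n)) (count-cong (λ T → suc ∣ T ∣ ≤? suc k) (λ T → ∣ T ∣ ≤? k) (mk⇔ ≤-pred s≤s) (allSubsets n)) ⟩
  count (λ T → ∣ T ∣ ≤? k) (allSubsets n) + count (λ T → ∣ T ∣ ≤? suc k) (allSubsets n)
    ≤⟨ +-mono-≤ (count-small-subsets n k) (count-small-subsets n (suc k)) ⟩
  suc (suc n) * suc n ^ k                                 ≤⟨ *-monoʳ-≤ (suc (suc n)) (^-monoˡ-≤ k (n≤1+n (suc n))) ⟩
  suc (suc n) ^ suc k                                     ∎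
  where open ≤-Reasoning

-- Graphs without surplus are rare

RowsWithin : Subset n → Subset n → BipGraph n → Set
RowsWithin S T G = AllOn (_⊆ T) S G

rowsWithin? : (S T : Subset n) → Decidable (RowsWithin S T)
rowsWithin? S T = allOn? (_⊆? T) S

⊆⇒AllOn-∁ : {r T : Subset n} → r ⊆ T → AllOn (_≡ false) (∁ T) r
⊆⇒AllOn-∁ {r = r} {T} r⊆T = AllOn⁺ (∁ T) r λ {i} i∈∁T → r[i]≡false i∈∁T
  where
  r[i]≡false : ∀ {i} → i ∈ ∁ T → lookup r i ≡ false
  r[i]≡false {i} i∈∁T with lookup r i in r[i]
  ... | false = refl
  ... | true  = contradiction (r⊆T (lookup⇒[]= i r r[i])) (x∈∁p⇒x∉p i∈∁T)

count-⊆ : (T : Subset n) → count (_⊆? T) (allSubsets n) * 2 ^ ∣ ∁ T ∣ ≤ 2 ^ n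
count-⊆ {n} T = begin
  count (_⊆? T) (allSubsets n) * 2 ^ ∣ ∁ T ∣
    ≤⟨ *-monoˡ-≤ (2 ^ ∣ ∁ T ∣) (count-mono (_⊆? T) (allOn? (Bool._≟ false) (∁ T)) ⊆⇒AllOn-∁ (allSubsets n)) ⟩
  count (allOn? (Bool._≟ false) (∁ T)) (allSubsets n) * 2 ^ ∣ ∁ T ∣
    ≤⟨ count-AllOn (Bool._≟ false) (true ∷ false ∷ []) ≤-refl (∁ T) ⟩
  2 ^ n ∎
  where open ≤-Reasoning

count-RowsWithin : (S T : Subset n) → count (rowsWithin? S T) (allGraphs n) * 2 ^ ((n ∸ ∣ T ∣) * ∣ S ∣) ≤ 2 ^ (n * n)
count-RowsWithin {n} S T = begin
  count (rowsWithin? S T) (allGraphs n) * 2 ^ ((n ∸ ∣ T ∣) * ∣ S ∣)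
    ≡⟨ cong (λ t → count (rowsWithin? S T) (allGraphs n) * 2 ^ (t * ∣ S ∣)) (∣∁p∣≡n∸∣p∣ T) ⟨
  count (rowsWithin? S T) (allGraphs n) * 2 ^ (∣ ∁ T ∣ * ∣ S ∣)
    ≡⟨ cong (count (rowsWithin? S T) (allGraphs n) *_) (^-*-assoc 2 ∣ ∁ T ∣ ∣ S ∣) ⟨
  count (rowsWithin? S T) (allGraphs n) * (2 ^ ∣ ∁ T ∣) ^ ∣ S ∣
    ≤⟨ count-AllOn (_⊆? T) (allSubsets n) (≤-trans (count-⊆ T) (≤-reflexive (sym (length-allSubsets n)))) S ⟩
  length (allSubsets n) ^ n
    ≡⟨ cong (_^ n) (length-allSubsets n) ⟩
  (2 ^ n) ^ n
    ≡⟨ ^-*-assoc 2 n n ⟩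
  2 ^ (n * n) ∎
  where open ≤-Reasoning

count-RowsWithin-≤ : (S T : Subset n) {x c : ℕ} → x ≤ (n ∸ ∣ T ∣) * ∣ S ∣ + c →
                     count (rowsWithin? S T) (allGraphs n) * 2 ^ x ≤ 2 ^ c * 2 ^ (n * n)
count-RowsWithin-≤ {n} S T {x} {c} x≤ = begin
  hits * 2 ^ x             ≤⟨ *-monoʳ-≤ hits (^-monoʳ-≤ 2 x≤) ⟩
  hits * 2 ^ (a + c)       ≡⟨ cong (hits *_) (^-distribˡ-+-* 2 a c) ⟩
  hits * (2 ^ a * 2 ^ c)   ≡⟨ *-assoc hits (2 ^ a) (2 ^ c) ⟨
  hits * 2 ^ a * 2 ^ c     ≤⟨ *-monoˡ-≤ (2 ^ c) (count-RowsWithin S T) ⟩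
  2 ^ (n * n) * 2 ^ c      ≡⟨ *-comm (2 ^ (n * n)) (2 ^ c) ⟩
  2 ^ c * 2 ^ (n * n)      ∎
  where
  open ≤-Reasoning
  hits a : ℕ
  hits = count (rowsWithin? S T) (allGraphs n)
  a = (n ∸ ∣ T ∣) * ∣ S ∣

SurplusViolation : Family n n → Subset n → Set
SurplusViolation {n} F S = 0 < ∣ S ∣ × ∣ S ∣ < n × ∣ neighbours F S ∣ ≤ ∣ S ∣

Surplus-or-violation : (F : Family n n) → Surplus F ⊎ ∃ (SurplusViolation F)
Surplus-or-violation {n} F with anySubset? (λ S → 0 <? ∣ S ∣ ×-dec ∣ S ∣ <? n ×-dec ∣ neighbours F S ∣ ≤? ∣ S ∣)
... | yes violation  = inj₂ violation
... | no ¬violation = inj₁ λ S 0<∣S∣ ∣S∣<n → ≰⇒> λ ∣N∣≤∣S∣ → ¬violation (S , 0<∣S∣ , ∣S∣<n , ∣N∣≤∣S∣)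

surplus? : (F : Family n n) → Dec (Surplus F)
surplus? F with Surplus-or-violation F
... | inj₁ surplus                   = yes surplus
... | inj₂ (S , 0<∣S∣ , ∣S∣<n , ∣N∣≤∣S∣) = no λ surplus → <⇒≱ (surplus S 0<∣S∣ ∣S∣<n) ∣N∣≤∣S∣

Event : ℕ → Set
Event n = Subset n × Subset n

Occurs : Event n → BipGraph n → Set
Occurs (S , T) = RowsWithin S T

occurs? : (e : Event n) → Decidable (Occurs e)
occurs? (S , T) = rowsWithin? S T

smallSubsets : (n : ℕ) → List (Subset n)
smallSubsets n = filter (λ T → ∣ T ∣ ≤? 2) (allSubsets n)

smallEvents : (n : ℕ) → List (Event n)
smallEvents n = map (λ (i , T) → ⁅ i ⁆ , T) (cartesianProduct (allFin n) (smallSubsets n))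

largeEvents : (n : ℕ) → List (Event n)
largeEvents n = map (λ (U , j) → ∁ U , ∁ ⁅ j ⁆) (cartesianProduct (smallSubsets n) (allFin n))

Medium : Event n → Set
Medium {n} (S , T) = 3 ≤ ∣ S ∣ × ∣ S ∣ + 3 ≤ n × ∣ T ∣ ≤ ∣ S ∣

medium? : Decidable (Medium {n})
medium? {n} (S , T) = 3 ≤? ∣ S ∣ ×-dec ∣ S ∣ + 3 ≤? n ×-dec ∣ T ∣ ≤? ∣ S ∣

mediumEvents : (n : ℕ) → List (Event n)
mediumEvents n = filter medium? (cartesianProduct (allSubsets n) (allSubsets n))

Caught : List (Event n) → BipGraph n → Set
Caught es G = Any (λ e → Occurs e G) es

caught? : (es : List (Event n)) → Decidable (Caught es)
caught? es G = any? (λ e → occurs? e G) es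

module _ (G : BipGraph n) (S : Subset n) where

  private
    T : Subset n
    T = neighbours (rows G) S

    rows⊆T : ∀ {i} → i ∈ S → rows G i ⊆ T
    rows⊆T i∈S = ∈-neighbours⁺ (rows G) S i∈S

  small-violation-caught : {i : Fin n} → i ∈ S → ∣ T ∣ ≤ 2 → Caught (smallEvents n) G
  small-violation-caught {i} i∈S ∣T∣≤2 = lose (∈-map⁺ _ (∈-cartesianProduct⁺ (∈-allFin i) T∈small)) occurs
    where
    T∈small : T ∈ₗ smallSubsets n
    T∈small = ∈-filter⁺ (λ T → ∣ T ∣ ≤? 2) (∈-allSubsets T) ∣T∣≤2
    occurs : RowsWithin ⁅ i ⁆ T G
    occurs = AllOn⁺ {P = _⊆ T} ⁅ i ⁆ G λ a∈ → rows⊆T (subst (_∈ S) (sym (x∈⁅y⁆⇒x≡y i a∈)) i∈S)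

  large-violation-caught : {j : Fin n} → j ∉ T → ∣ ∁ S ∣ ≤ 2 → Caught (largeEvents n) G
  large-violation-caught {j} j∉T ∣∁S∣≤2 = lose (∈-map⁺ _ (∈-cartesianProduct⁺ ∁S∈small (∈-allFin j))) occurs
    where
    ∁S∈small : ∁ S ∈ₗ smallSubsets n
    ∁S∈small = ∈-filter⁺ (λ T → ∣ T ∣ ≤? 2) (∈-allSubsets (∁ S)) ∣∁S∣≤2
    occurs : RowsWithin (∁ (∁ S)) (∁ ⁅ j ⁆) G
    occurs = AllOn⁺ {P = _⊆ ∁ ⁅ j ⁆} (∁ (∁ S)) G λ a∈ c∈ →
      x∉p⇒x∈∁p (x≢y⇒x∉⁅y⁆ λ { refl → j∉T (rows⊆T (x∉∁p⇒x∈p (x∈∁p⇒x∉p a∈)) c∈) })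

  medium-violation-caught : Medium (S , T) → Caught (mediumEvents n) G
  medium-violation-caught medium =
    lose (∈-filter⁺ medium? (∈-cartesianProduct⁺ (∈-allSubsets S) (∈-allSubsets T)) medium) (AllOn⁺ {P = _⊆ T} S G rows⊆T)

  SurplusViolation⇒Caught : SurplusViolation (rows G) S →
                            Caught (smallEvents n) G ⊎ Caught (largeEvents n) G ⊎ Caught (mediumEvents n) G
  SurplusViolation⇒Caught (0<∣S∣ , ∣S∣<n , ∣T∣≤∣S∣) with ∣ S ∣ ≤? 2 | n ≤? ∣ S ∣ + 2
  ... | yes ∣S∣≤2 | _ =
    inj₁ (small-violation-caught (proj₂ (0<∣p∣⇒Nonempty S 0<∣S∣)) (≤-trans ∣T∣≤∣S∣ ∣S∣≤2))
  ... | no _ | yes n≤∣S∣+2 with Fin.all? (_∈? T)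
  ...   | yes all∈T = contradiction (≤-trans (≤-reflexive (sym (∣⊤∣≡n n))) (p⊆q⇒∣p∣≤∣q∣ {p = ⊤} {q = T} λ {j} _ → all∈T j))
                                   (<⇒≱ (≤-<-trans ∣T∣≤∣S∣ ∣S∣<n))
  ...   | no ¬all∈T =
    let j , j∉T = Fin.¬∀⟶∃¬ n _ (_∈? T) ¬all∈T in
    inj₂ (inj₁ (large-violation-caught j∉T
      (≤-trans (≤-reflexive (∣∁p∣≡n∸∣p∣ S)) (m≤n+o⇒m∸n≤o n ∣ S ∣ n≤∣S∣+2))))
  SurplusViolation⇒Caught (0<∣S∣ , ∣S∣<n , ∣T∣≤∣S∣) | no ∣S∣≰2 | no n≰∣S∣+2 =
    inj₂ (inj₂ (medium-violation-caught (≰⇒> ∣S∣≰2 , ≤-trans (≤-reflexive (+-suc ∣ S ∣ 2)) (≰⇒> n≰∣S∣+2) , ∣T∣≤∣S∣)))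

count-Caught : (es : List (Event n)) {x c : ℕ} → (∀ {S T} → (S , T) ∈ₗ es → x ≤ (n ∸ ∣ T ∣) * ∣ S ∣ + c) →
               count (caught? es) (allGraphs n) * 2 ^ x ≤ length es * (2 ^ c * 2 ^ (n * n))
count-Caught es weight =
  count-union-bound (caught? es) occurs? (allGraphs _) es id λ {(S , T)} e∈ → count-RowsWithin-≤ S T (weight e∈)

n≤n∸t+2 : (n t : ℕ) → t ≤ 2 → n ≤ n ∸ t + 2
n≤n∸t+2 n t t≤2 = begin
  n             ≤⟨ m≤n+m∸n n t ⟩
  t + (n ∸ t)   ≤⟨ +-monoˡ-≤ (n ∸ t) t≤2 ⟩
  2 + (n ∸ t)   ≡⟨ +-comm 2 (n ∸ t) ⟩
  n ∸ t + 2     ∎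
  where open ≤-Reasoning

-- With s = 3 + a and n = s + 3 + b, the slack (n - s) s + 9 - 3 n is a b.
3n≤[n∸s]*s+9 : {n s : ℕ} → 3 ≤ s → s + 3 ≤ n → 3 * n ≤ (n ∸ s) * s + 9
3n≤[n∸s]*s+9 {n} {s} 3≤s s+3≤n
  with a , refl ← m≤n⇒∃[o]m+o≡n 3≤s
  with b , refl ← m≤n⇒∃[o]m+o≡n s+3≤n = begin
    3 * (3 + a + 3 + b)                           ≤⟨ m≤m+n _ (b * a) ⟩
    3 * (3 + a + 3 + b) + b * a                   ≡⟨ identity a b ⟩
    (3 + b) * (3 + a) + 9                         ≡⟨ cong (λ d → d * (3 + a) + 9) n∸s≡3+b ⟨
    (3 + a + 3 + b ∸ (3 + a)) * (3 + a) + 9       ∎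
  where
  open ≤-Reasoning
  identity : ∀ a b → 3 * (3 + a + 3 + b) + b * a ≡ (3 + b) * (3 + a) + 9
  identity = solve-∀
  n∸s≡3+b : 3 + a + 3 + b ∸ (3 + a) ≡ 3 + b
  n∸s≡3+b = trans (cong (_∸ (3 + a)) (+-assoc (3 + a) 3 b)) (m+n∸m≡n (3 + a) (3 + b))

8n[n+1]²+512≤2n⁴ : {n : ℕ} → 18 ≤ n → 8 * (n * suc n ^ 2) + 512 ≤ 2 * n ^ 4
8n[n+1]²+512≤2n⁴ {n} 18≤n = begin
  8 * (n * suc n ^ 2) + 512            ≤⟨ +-mono-≤ (*-monoʳ-≤ 8 (*-monoʳ-≤ n (^-monoˡ-≤ 2 1+n≤2n))) (^-monoˡ-≤ 3 8≤n) ⟩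
  8 * (n * (2 * n) ^ 2) + n ^ 3        ≡⟨ lhs n ⟩
  33 * n ^ 3                           ≤⟨ *-monoˡ-≤ (n ^ 3) 33≤2n ⟩
  2 * n * n ^ 3                        ≡⟨ rhs n ⟩
  2 * n ^ 4                            ∎
  where
  open ≤-Reasoning
  1+n≤2n : suc n ≤ 2 * n
  1+n≤2n = +-mono-≤ (≤-trans (s≤s z≤n) 18≤n) (≤-reflexive (sym (+-identityʳ n)))
  8≤n : 8 ≤ n
  8≤n = ≤-trans (m≤m+n 8 10) 18≤n
  33≤2n : 33 ≤ 2 * n
  33≤2n = ≤-trans (m≤m+n 33 3) (*-monoʳ-≤ 2 18≤n)
  lhs : ∀ n → 8 * (n * ((2 * n) * ((2 * n) * 1))) + n * (n * (n * 1)) ≡ 33 * (n * (n * (n * 1)))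
  lhs = solve-∀
  rhs : ∀ n → 2 * n * (n * (n * (n * 1))) ≡ 2 * (n * (n * (n * (n * 1))))
  rhs = solve-∀

2^n≤2n⁴-table : (i : Fin 18) → 2 ≤ toℕ i → 2 ^ toℕ i ≤ 2 * toℕ i ^ 4
2^n≤2n⁴-table = from-yes (Fin.all? {n = 18} λ i → 2 ≤? toℕ i →-dec 2 ^ toℕ i ≤? 2 * toℕ i ^ 4)

2^n≤2n⁴ : {n : ℕ} → 2 ≤ n → n ≤ 17 → 2 ^ n ≤ 2 * n ^ 4
2^n≤2n⁴ {n} 2≤n n≤17 = subst (λ m → 2 ^ m ≤ 2 * m ^ 4) (Fin.toℕ-fromℕ< (s≤s n≤17))
  (2^n≤2n⁴-table (fromℕ< (s≤s n≤17)) (subst (2 ≤_) (sym (Fin.toℕ-fromℕ< (s≤s n≤17))) 2≤n))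

length-smallEvents : (n : ℕ) → length (smallEvents n) ≤ n * suc n ^ 2
length-smallEvents n = begin
  length (smallEvents n)                                    ≡⟨ length-map _ (cartesianProduct (allFin n) (smallSubsets n)) ⟩
  length (cartesianProduct (allFin n) (smallSubsets n))     ≡⟨ length-cartesianProductWith _,_ (allFin n) (smallSubsets n) ⟩
  length (allFin n) * length (smallSubsets n)               ≡⟨ cong (_* length (smallSubsets n)) (length-tabulate {n = n} id) ⟩
  n * length (smallSubsets n)                               ≤⟨ *-monoʳ-≤ n (count-small-subsets n 2) ⟩
  n * suc n ^ 2                                             ∎
  where open ≤-Reasoning

length-largeEvents : (n : ℕ) → length (largeEvents n) ≤ n * suc n ^ 2
length-largeEvents n = begin
  length (largeEvents n)                                    ≡⟨ length-map _ (cartesianProduct (smallSubsets n) (allFin n)) ⟩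
  length (cartesianProduct (smallSubsets n) (allFin n))     ≡⟨ length-cartesianProductWith _,_ (smallSubsets n) (allFin n) ⟩
  length (smallSubsets n) * length (allFin n)               ≡⟨ cong (length (smallSubsets n) *_) (length-tabulate {n = n} id) ⟩
  length (smallSubsets n) * n                               ≤⟨ *-monoˡ-≤ n (count-small-subsets n 2) ⟩
  suc n ^ 2 * n                                             ≡⟨ *-comm (suc n ^ 2) n ⟩
  n * suc n ^ 2                                             ∎
  where open ≤-Reasoning

length-mediumEvents : (n : ℕ) → length (mediumEvents n) ≤ 2 ^ n * 2 ^ n
length-mediumEvents n = begin
  length (mediumEvents n)                                   ≤⟨ length-filter medium? (cartesianProduct (allSubsets n) (allSubsets n)) ⟩
  length (cartesianProduct (allSubsets n) (allSubsets n))   ≡⟨ length-cartesianProductWith _,_ (allSubsets n) (allSubsets n) ⟩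
  length (allSubsets n) * length (allSubsets n)             ≡⟨ cong₂ _*_ (length-allSubsets n) (length-allSubsets n) ⟩
  2 ^ n * 2 ^ n                                             ∎
  where open ≤-Reasoning

smallEvents-weight : {S T : Subset n} → (S , T) ∈ₗ smallEvents n → n ≤ (n ∸ ∣ T ∣) * ∣ S ∣ + 2
smallEvents-weight {n} e∈ with (i , T) , p∈ , refl ← ∈-map⁻ _ e∈ = begin
  n                           ≤⟨ n≤n∸t+2 n ∣ T ∣ ∣T∣≤2 ⟩
  n ∸ ∣ T ∣ + 2               ≡⟨ cong (_+ 2) (*-identityʳ (n ∸ ∣ T ∣)) ⟨
  (n ∸ ∣ T ∣) * 1 + 2         ≡⟨ cong (λ s → (n ∸ ∣ T ∣) * s + 2) (∣⁅x⁆∣≡1 i) ⟨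
  (n ∸ ∣ T ∣) * ∣ ⁅ i ⁆ ∣ + 2 ∎
  where
  open ≤-Reasoning
  ∣T∣≤2 : ∣ T ∣ ≤ 2
  ∣T∣≤2 = proj₂ (∈-filter⁻ (λ T → ∣ T ∣ ≤? 2) {xs = allSubsets n} (proj₂ (∈-cartesianProduct⁻ (allFin n) (smallSubsets n) p∈)))

largeEvents-weight : {S T : Subset n} → (S , T) ∈ₗ largeEvents n → n ≤ (n ∸ ∣ T ∣) * ∣ S ∣ + 2
largeEvents-weight {n} e∈ with (U , j) , p∈ , refl ← ∈-map⁻ _ e∈ = begin
  n                                 ≤⟨ n≤n∸t+2 n ∣ U ∣ ∣U∣≤2 ⟩
  n ∸ ∣ U ∣ + 2                     ≡⟨ cong (λ s → s + 2) (trans (*-identityˡ _) (∣∁p∣≡n∸∣p∣ U)) ⟨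
  1 * ∣ ∁ U ∣ + 2                   ≡⟨ cong (λ d → d * ∣ ∁ U ∣ + 2) n∸∣∁⁅j⁆∣≡1 ⟨
  (n ∸ ∣ ∁ ⁅ j ⁆ ∣) * ∣ ∁ U ∣ + 2   ∎
  where
  open ≤-Reasoning
  ∣U∣≤2 : ∣ U ∣ ≤ 2
  ∣U∣≤2 = proj₂ (∈-filter⁻ (λ T → ∣ T ∣ ≤? 2) {xs = allSubsets n} (proj₁ (∈-cartesianProduct⁻ (smallSubsets n) (allFin n) p∈)))
  n∸∣∁⁅j⁆∣≡1 : n ∸ ∣ ∁ ⁅ j ⁆ ∣ ≡ 1
  n∸∣∁⁅j⁆∣≡1 = begin-equality
    n ∸ ∣ ∁ ⁅ j ⁆ ∣       ≡⟨ cong (n ∸_) (∣∁p∣≡n∸∣p∣ ⁅ j ⁆) ⟩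
    n ∸ (n ∸ ∣ ⁅ j ⁆ ∣)   ≡⟨ m∸[m∸n]≡n (∣p∣≤n ⁅ j ⁆) ⟩
    ∣ ⁅ j ⁆ ∣             ≡⟨ ∣⁅x⁆∣≡1 j ⟩
    1                     ∎

mediumEvents-weight : {S T : Subset n} → (S , T) ∈ₗ mediumEvents n → n + (n + n) ≤ (n ∸ ∣ T ∣) * ∣ S ∣ + 9
mediumEvents-weight {n} {S} {T} e∈ with 3≤∣S∣ , ∣S∣+3≤n , ∣T∣≤∣S∣ ← proj₂ (∈-filter⁻ medium? {xs = cartesianProduct (allSubsets n) (allSubsets n)} e∈) = begin
  n + (n + n)                 ≡⟨ cong (λ m → n + (n + m)) (+-identityʳ n) ⟨
  3 * n                       ≤⟨ 3n≤[n∸s]*s+9 3≤∣S∣ ∣S∣+3≤n ⟩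
  (n ∸ ∣ S ∣) * ∣ S ∣ + 9     ≤⟨ +-monoˡ-≤ 9 (*-monoˡ-≤ ∣ S ∣ (∸-monoʳ-≤ n ∣T∣≤∣S∣)) ⟩
  (n ∸ ∣ T ∣) * ∣ S ∣ + 9     ∎
  where open ≤-Reasoning

¬Surplus⇒Caught : (G : BipGraph n) → ¬ Surplus (rows G) →
                  Caught (smallEvents n) G ⊎ Caught (largeEvents n) G ⊎ Caught (mediumEvents n) G
¬Surplus⇒Caught G ¬surplus with Surplus-or-violation (rows G)
... | inj₁ surplus         = contradiction surplus ¬surplus
... | inj₂ (S , violation) = SurplusViolation⇒Caught G S violation

count-¬Surplus : {n : ℕ} → 1 < n → count (¬? ∘ surplus? ∘ rows) (allGraphs n) * 2 ^ n ≤ 2 ^ (n * n) * (2 * n ^ 4)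
count-¬Surplus {n} 1<n with n ≤? 17
... | yes n≤17 =
  *-mono-≤ (≤-trans (length-filter _ (allGraphs n)) (≤-reflexive (length-allGraphs n))) (2^n≤2n⁴ 1<n n≤17)
... | no  n≰17 = begin
  bad * 2 ^ n                                                      ≤⟨ *-monoˡ-≤ (2 ^ n) bad≤ ⟩
  (small + (large + medium)) * 2 ^ n                               ≡⟨ distribute ⟩
  small * 2 ^ n + (large * 2 ^ n + medium * 2 ^ n)                 ≤⟨ +-mono-≤ small*2ⁿ≤ (+-mono-≤ large*2ⁿ≤ medium*2ⁿ≤512N) ⟩
  n * suc n ^ 2 * (4 * N) + (n * suc n ^ 2 * (4 * N) + 512 * N)    ≡⟨ collect (n * suc n ^ 2) N ⟩
  (8 * (n * suc n ^ 2) + 512) * N                                  ≤⟨ *-monoˡ-≤ N (8n[n+1]²+512≤2n⁴ (≰⇒> n≰17)) ⟩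
  2 * n ^ 4 * N                                                    ≡⟨ *-comm (2 * n ^ 4) N ⟩
  N * (2 * n ^ 4)                                                  ∎
  where
  open ≤-Reasoning
  N bad small large medium : ℕ
  N      = 2 ^ (n * n)
  bad    = count (¬? ∘ surplus? ∘ rows) (allGraphs n)
  small  = count (caught? (smallEvents n)) (allGraphs n)
  large  = count (caught? (largeEvents n)) (allGraphs n)
  medium = count (caught? (mediumEvents n)) (allGraphs n)

  large-or-medium? : Decidable (λ G → Caught (largeEvents n) G ⊎ Caught (mediumEvents n) G)
  large-or-medium? G = caught? (largeEvents n) G ⊎-dec caught? (mediumEvents n) G

  bad≤ : bad ≤ small + (large + medium)
  bad≤ = ≤-trans (count-⊎-≤ _ (caught? (smallEvents n)) large-or-medium? (λ {G} → ¬Surplus⇒Caught G) (allGraphs n))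
                 (+-monoʳ-≤ small (count-⊎-≤ large-or-medium? (caught? (largeEvents n)) (caught? (mediumEvents n)) id (allGraphs n)))

  distribute : (small + (large + medium)) * 2 ^ n ≡ small * 2 ^ n + (large * 2 ^ n + medium * 2 ^ n)
  distribute = trans (*-distribʳ-+ (2 ^ n) small _) (cong (small * 2 ^ n +_) (*-distribʳ-+ (2 ^ n) large medium))

  collect : ∀ a N → a * (4 * N) + (a * (4 * N) + 512 * N) ≡ (8 * a + 512) * N
  collect = solve-∀

  small*2ⁿ≤ : small * 2 ^ n ≤ n * suc n ^ 2 * (4 * N)
  small*2ⁿ≤ = ≤-trans (count-Caught (smallEvents n) smallEvents-weight) (*-monoˡ-≤ (4 * N) (length-smallEvents n))

  large*2ⁿ≤ : large * 2 ^ n ≤ n * suc n ^ 2 * (4 * N)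
  large*2ⁿ≤ = ≤-trans (count-Caught (largeEvents n) largeEvents-weight) (*-monoˡ-≤ (4 * N) (length-largeEvents n))

  -- Medium events are only rare enough with the weight 2 ^ (3 n);
  -- the extra factor 2 ^ (2 n) then cancels.
  medium*2ⁿ≤512N : medium * 2 ^ n ≤ 512 * N
  medium*2ⁿ≤512N = *-cancelʳ-≤ (medium * 2 ^ n) (512 * N) (2 ^ n * 2 ^ n) {{m*n≢0 (2 ^ n) (2 ^ n) {{m^n≢0 2 n}} {{m^n≢0 2 n}}}}
    (begin
      medium * 2 ^ n * (2 ^ n * 2 ^ n)      ≡⟨ *-assoc medium (2 ^ n) _ ⟩
      medium * (2 ^ n * (2 ^ n * 2 ^ n))    ≡⟨ cong (medium *_) 2ⁿ⁺ⁿ⁺ⁿ≡2ⁿ*[2ⁿ*2ⁿ] ⟨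
      medium * 2 ^ (n + (n + n))            ≤⟨ count-Caught (mediumEvents n) mediumEvents-weight ⟩
      length (mediumEvents n) * (2 ^ 9 * N) ≤⟨ *-monoˡ-≤ (2 ^ 9 * N) (length-mediumEvents n) ⟩
      2 ^ n * 2 ^ n * (512 * N)             ≡⟨ *-comm (2 ^ n * 2 ^ n) (512 * N) ⟩
      512 * N * (2 ^ n * 2 ^ n)             ∎)
    where
    2ⁿ⁺ⁿ⁺ⁿ≡2ⁿ*[2ⁿ*2ⁿ] : 2 ^ (n + (n + n)) ≡ 2 ^ n * (2 ^ n * 2 ^ n)
    2ⁿ⁺ⁿ⁺ⁿ≡2ⁿ*[2ⁿ*2ⁿ] = trans (^-distribˡ-+-* 2 n (n + n)) (cong (2 ^ n *_) (^-distribˡ-+-* 2 n n))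

Elementary⇒MatchingCovered-AtLeast : (k : ℕ) → AtLeast {n} Elementary k → AtLeast {n} MatchingCovered k
Elementary⇒MatchingCovered-AtLeast k (Gs , unique , elementary , length≡k) =
  Gs , unique , All.map proj₂ elementary , length≡k

surplusGraphs : (n : ℕ) → List (BipGraph n)
surplusGraphs n = filter (surplus? ∘ rows) (allGraphs n)

surplusGraphs-Unique : (n : ℕ) → Unique (surplusGraphs n)
surplusGraphs-Unique n = Unique.filter⁺ (surplus? ∘ rows) (allGraphs-Unique n)

surplusGraphs-Elementary : 1 < n → All.All Elementary (surplusGraphs n)
surplusGraphs-Elementary {n} 1<n = All.map (Surplus⇒Elementary 1<n) (all-filter (surplus? ∘ rows) (allGraphs n))

length-surplusGraphs : 1 < n → 2 ^ (n * n) * 2 ^ n ≤ length (surplusGraphs n) * 2 ^ n + 2 ^ (n * n) * (2 * n ^ 4)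
length-surplusGraphs {n} 1<n = begin
  2 ^ (n * n) * 2 ^ n                       ≡⟨ cong (_* 2 ^ n) N≡good+bad ⟩
  (good + bad) * 2 ^ n                      ≡⟨ *-distribʳ-+ (2 ^ n) good bad ⟩
  good * 2 ^ n + bad * 2 ^ n                ≤⟨ +-monoʳ-≤ (good * 2 ^ n) (count-¬Surplus 1<n) ⟩
  good * 2 ^ n + 2 ^ (n * n) * (2 * n ^ 4)  ∎
  where
  open ≤-Reasoning
  good bad : ℕ
  good = count (surplus? ∘ rows) (allGraphs n)
  bad  = count (¬? ∘ surplus? ∘ rows) (allGraphs n)
  N≡good+bad : 2 ^ (n * n) ≡ good + bad
  N≡good+bad = trans (sym (length-allGraphs n)) (sym (count+count-¬≡length (surplus? ∘ rows) (allGraphs n)))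

proposition3p10 : (n : ℕ) → 1 < n →
    ((k : ℕ) → AtLeast {n} Elementary k → AtLeast {n} MatchingCovered k)
    × Σ ℕ (λ k → AtLeast {n} Elementary k
                 × (2 ^ (n * n)) * (2 ^ n) ≤ k * (2 ^ n) + (2 ^ (n * n)) * (2 * n ^ 4))
proposition3p10 n 1<n =
  Elementary⇒MatchingCovered-AtLeast ,
  length (surplusGraphs n) ,
  (surplusGraphs n , surplusGraphs-Unique n , surplusGraphs-Elementary 1<n , refl) ,
  length-surplusGraphs 1<n
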